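{- Let $P$ be a unit interval order canonically labeled by $[n]$, and let $\{[q_i,q_i+1]\mid 1\le i\le n\}$ be an interval representation of $P$ with $q_1<\dots<q_n$. Label the left endpoint $q_i$ by $n+i$ and the right endpoint $q_i+1$ by $n+1-i$, for each $i\in[n]$. Let $(s_1,\dots,s_{2n})$ be the sequence of these $2n$ labels read from right to left on the real line. Then the decorated permutation associated to the unit interval positroid induced by $P$ is the cycle $(s_1\ s_2\ \dots\ s_{2n})$.
   Context: A poset $P$ is a unit interval order if there is a bijection $i\mapsto[q_i,q_i+1]$ to closed unit intervals of $\mathbb{R}$ (an interval representation) with $i<_P j$ iff $q_i+1<q_j$. For a poset labeled bijectively by $[n]$, the altitude of $i$ is $\alpha(i)=|\{j: j\le_P i\}|-|\{j: i\le_P j\}|$; the labeling is canonical if $\alpha(i)<\alpha(j)$ implies $i<j$. The antiadjacency matrix is the $n\times n$ $0/1$ matrix $(a_{i,j})$ with $a_{i,j}=0$ iff $i<_P j$. For an $n\times n$ matrix $A=(a_{i,j})$, $\psi(A)$ is the $n\times 2n$ matrix whose first $n$ columns form $I_n$ and whose column $n+j$ has entry $(-1)^{n-i}a_{n+1-i,j}$ in row $i$; the unit interval positroid induced by $P$ is the matroid on $[2n]$ whose bases are the $n$-subsets indexing linearly independent columns of $\psi(A)$, $A$ the antiadjacency matrix. For $i\in[2n]$ let $<_i$ be $i<_i\dots<_i 2n<_i 1<_i\dots<_i i-1$ and $I_i$ the lexicographically minimal basis w.r.t. $<_i$ (indices mod $2n$); the associated decorated permutation $\sigma$ is given by $\sigma(j)=i$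 if $I_{i+1}=(I_i\setminus\{i\})\cup\{j\}$, $j\neq i$, and $i$ is a fixed point (clockwise if $i\notin I_i$, counterclockwise if $i\in I_i$) if $I_{i+1}=I_i$. The cycle $(s_1\ \dots\ s_{2n})$ sends $s_k\mapsto s_{k+1}$ and $s_{2n}\mapsto s_1$.
   Formalization: The interval representation takes rational values rather than values in ℝ, and coinciding endpoints $q_i+1$ and $q_j$ are ordered with the right endpoint $q_i+1$ lying to the right of $q_j$. -}

module Defs where

open import Data.Bool using (Bool; true; false; if_then_else_)
open import Data.Nat as ℕ using (ℕ; zero; suc; _∸_)
open import Data.Nat.DivMod using (_mod_)
open import Data.Integer as ℤ using (ℤ)
open import Data.Rational using (ℚ; 0ℚ; 1ℚ; _+_; _*_; -_; _<_)
open import Data.Rational.Properties using (_<?_)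
open import Data.Fin as Fin using (Fin; toℕ; splitAt; opposite)
open import Data.Fin.Subset using (Subset; _∈_; _∉_; ∣_∣)
open import Data.Fin.Subset.Properties using (_∈?_)
open import Data.List using (List; []; _∷_; _++_; drop; take; filter; allFin)
open import Data.Sum using (_⊎_; inj₁; inj₂)
open import Data.Product using (_×_; Σ; ∃)
open import Relation.Nullary using (¬_; does)
open import Relation.Binary.PropositionalEquality using (_≡_; _≢_)

sumF : ∀ {n} → (Fin n → ℚ) → ℚ
sumF {zero}  f = 0ℚ
sumF {suc n} f = f Fin.zero + sumF (λ k → f (Fin.suc k))

countF : ∀ {n} → (Fin n → Bool) → ℕ
countF {zero}  p = 0
countF {suc n} p = (if p Fin.zero then 1 else 0) ℕ.+ countF (λ k → p (Fin.suc k))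

-- The poset P on [n] (0-based: Fin n) given by an interval representation
-- i ↦ [q i, q i + 1]:  i <_P j  iff  q i + 1 < q j.

_<P_ : ∀ {n} → (Fin n → ℚ) → Fin n → Fin n → Set
(q <P i) j = q i + 1ℚ < q j

leP? : ∀ {n} → (Fin n → ℚ) → Fin n → Fin n → Bool
leP? q i j = does (i Fin.≟ j) Data.Bool.∨ does (q i + 1ℚ <? q j)
  where import Data.Bool

altitude : ∀ {n} → (Fin n → ℚ) → Fin n → ℤ
altitude q i = ℤ.+ (countF (λ j → leP? q j i)) ℤ.- ℤ.+ (countF (λ j → leP? q i j))

Canonical : ∀ {n} → (Fin n → ℚ) → Set
Canonical q = ∀ i j → altitude q i ℤ.< altitude q j → i Fin.< j

StrictlyIncreasing : ∀ {n} → (Fin n → ℚ) → Set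
StrictlyIncreasing q = ∀ i j → i Fin.< j → q i < q j

antiadj : ∀ {n} → (Fin n → ℚ) → Fin n → Fin n → ℚ
antiadj q i j = if does (q i + 1ℚ <? q j) then 0ℚ else 1ℚ

sign : ℕ → ℚ
sign zero    = 1ℚ
sign (suc k) = - sign k

-- ψ(A): n × 2n, columns indexed by Fin (n + n) (0-based).
-- Column c < n is the c-th unit vector; column n + j has in row r
-- (0-based; row i = r + 1) the entry (-1)^(n-1-r) a_{n-1-r, j}.
psi : ∀ {n} → (Fin n → Fin n → ℚ) → Fin n → Fin (n ℕ.+ n) → ℚ
psi {n} A r c with splitAt n c
... | inj₁ k = if does (r Fin.≟ k) then 1ℚ else 0ℚ
... | inj₂ j = sign (n ∸ suc (toℕ r)) * A (opposite r) j

-- Matroid of a matrix: bases are n-subsets of linearly independent columns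
-- (over ℚ; entries are integers so this agrees with independence over ℝ).

LinIndepCols : ∀ {n m} → (Fin n → Fin m → ℚ) → Subset m → Set
LinIndepCols {n} {m} M S =
  (c : Fin m → ℚ) → (∀ k → k ∉ S → c k ≡ 0ℚ) →
  (∀ r → sumF (λ k → c k * M r k) ≡ 0ℚ) → ∀ k → c k ≡ 0ℚ

IsBasis : ∀ {n m} → (Fin n → Fin m → ℚ) → Subset m → Set
IsBasis {n} M S = ∣ S ∣ ≡ n × LinIndepCols M S

PositroidBasis : ∀ {n} → (Fin n → ℚ) → Subset (n ℕ.+ n) → Set
PositroidBasis q = IsBasis (psi (antiadj q))

orderFrom : ∀ {m} → Fin m → List (Fin m)
orderFrom {m} i = drop (toℕ i) (allFin m) ++ take (toℕ i) (allFin m)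

posFrom : ∀ {m} → Fin m → Fin m → ℕ
posFrom {m} i k = if toℕ i ℕ.≤ᵇ toℕ k then toℕ k ∸ toℕ i else (toℕ k ℕ.+ m) ∸ toℕ i

sortedFrom : ∀ {m} → Fin m → Subset m → List (Fin m)
sortedFrom i S = filter (_∈? S) (orderFrom i)

data LexLt {m} (i : Fin m) : List (Fin m) → List (Fin m) → Set where
  here  : ∀ {x y xs ys} → posFrom i x ℕ.< posFrom i y → LexLt i (x ∷ xs) (y ∷ ys)
  there : ∀ {x xs ys} → LexLt i xs ys → LexLt i (x ∷ xs) (x ∷ ys)

LexMinBasis : ∀ {n} → (Fin n → ℚ) → Fin (n ℕ.+ n) → Subset (n ℕ.+ n) → Set
LexMinBasis q i I =
  PositroidBasis q I × (∀ J → PositroidBasis q J → ¬ LexLt i (sortedFrom i J) (sortedFrom i I))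

nextMod : ∀ {m} → Fin m → Fin m
nextMod {suc m} i = suc (toℕ i) mod (suc m)

-- Paper label L corresponds to Fin index L - 1.
-- Index c = splitAt n c = inj₂ k  (paper label n+k+1): left endpoint q_k.
-- Index c = inj₁ k (paper label k+1 = n+1-i with i = n-k): right endpoint
-- of element opposite k, i.e. q (opposite k) + 1.

endpointValue : ∀ {n} → (Fin n → ℚ) → Fin (n ℕ.+ n) → ℚ
endpointValue {n} q c with splitAt n c
... | inj₁ k = q (opposite k) + 1ℚ
... | inj₂ k = q k

IsRightEndpoint : ∀ {n} → Fin (n ℕ.+ n) → Set
IsRightEndpoint {n} c = ∃ λ k → splitAt n c ≡ inj₁ k

IsLeftEndpoint : ∀ {n} → Fin (n ℕ.+ n) → Set
IsLeftEndpoint {n} c = ∃ λ k → splitAt n c ≡ inj₂ k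

-- label a lies strictly to the right of label b on the real line;
-- a coincidence q_i + 1 = q_j (closed intervals meeting) is read with the
-- right endpoint q_i + 1 to the right of the left endpoint q_j.
RightOf : ∀ {n} → (Fin n → ℚ) → Fin (n ℕ.+ n) → Fin (n ℕ.+ n) → Set
RightOf {n} q a b =
  endpointValue q b < endpointValue q a
  ⊎ (endpointValue q a ≡ endpointValue q b × IsRightEndpoint {n} a × IsLeftEndpoint {n} b)

-- CycleStep q j i : the cycle (s_1 ... s_2n), with s read right to left,
-- sends j to i: i is immediately to the left of j, or j is the leftmost
-- label (s_2n) and i the rightmost (s_1).
CycleStep : ∀ {n} → (Fin n → ℚ) → Fin (n ℕ.+ n) → Fin (n ℕ.+ n) → Set
CycleStep q j i =
  (RightOf q j i × (∀ k → ¬ (RightOf q j k × RightOf q k i)))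
  ⊎ ((∀ k → k ≢ j → RightOf q k j) × (∀ k → k ≢ i → RightOf q i k))

-- Corollary 5.8: for a unit interval order given by an interval
-- representation q_0 < ... < q_{n-1}, the decorated permutation of the
-- induced unit interval positroid is the cycle of the 2n endpoint labels
-- read from right to left.
--
-- Let σ send each endpoint label to the label read right after it
-- (the leftmost one, q_0, to the rightmost one, q_{n-1} + 1) and, for a
-- start label c, let G c be the set of labels x read before σ x in the
-- cyclic order <_c.  Then
--  * G c is a basis of ψ(A): for c = 1 it is the identity block, and
--    G (c+1) = (G c - c) ∪ {σ⁻¹ c} is an exchange that keeps independence,
--    witnessed by a row functional of ψ(A) that is ±1 at σ⁻¹ c;
--  * G c is greedy for <_c: each column outside it is an explicit
--    combination of earlier columns, so by a general matroid criterion it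
--    is the unique lexicographically minimal basis I_c.
-- Hence I_{c+1} = (I_c - c) ∪ {σ⁻¹ c}: the decorated permutation is σ.

module Submission where

open import Defs
open import Data.Nat using (ℕ)
open import Data.Rational using (ℚ)
open import Data.Fin using (Fin)
open import Data.Fin.Subset using (Subset; _-_; _∪_; ⁅_⁆)
open import Data.Product using (_×_; ∃)
open import Relation.Binary.PropositionalEquality using (_≡_; _≢_)

open import Data.Nat using (suc)
open import Data.Product using (_,_)
open import Relation.Binary.PropositionalEquality using (cong; trans; sym)


module CyclicOrder where
  open import Defs using (nextMod)
  open import Data.Nat
  open import Data.Nat.Properties
  open import Data.Nat.DivMod using (_%_; m<n⇒m%n≡m; n%n≡0)
  open import Data.Fin as Fin using (Fin; toℕ)
  import Data.Fin.Properties as FinP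
  open import Data.Bool using (true; false; T; if_then_else_)
  open import Data.Sum using (_⊎_; inj₁; inj₂)
  open import Data.Product using (_×_; _,_)
  open import Data.Empty using (⊥; ⊥-elim)
  open import Relation.Binary.PropositionalEquality
  open import Relation.Binary.Definitions using (tri<; tri≈; tri>)
  open import Relation.Nullary using (yes; no; Dec)
  open import Relation.Nullary.Decidable using (_×-dec_; _⊎-dec_)

  -- `CycLt c a b` : a comes strictly before b in the cyclic order
  -- c <_c c+1 <_c ... <_c m-1 <_c 0 <_c ... <_c c-1 (for a, b, c < m).
  CycLt : ℕ → ℕ → ℕ → Set
  CycLt c a b = (c ≤ a × a < b) ⊎ (a < b × b < c) ⊎ (b < c × c ≤ a)

  cycPos : ℕ → ℕ → ℕ → ℕ
  cycPos m c z = if c ≤ᵇ z then z ∸ c else (z + m) ∸ c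

  cycPos-≥ : ∀ m c z → c ≤ z → cycPos m c z ≡ z ∸ c
  cycPos-≥ m c z c≤z with c ≤ᵇ z | ≤⇒≤ᵇ c≤z
  ... | true | _ = refl

  cycPos-< : ∀ m c z → z < c → cycPos m c z ≡ (z + m) ∸ c
  cycPos-< m c z z<c with c ≤ᵇ z in eq
  ... | false = refl
  ... | true = ⊥-elim (<⇒≱ z<c (≤ᵇ⇒≤ c z (subst T (sym eq) _)))

  -- `CycLt` is exactly the order of positions, so it is the order `posFrom`
  -- uses to sort lists; this is how the lexicographic order is reached.
  cycLt⇒pos< : ∀ m c a b → a < m → c < m → CycLt c a b → cycPos m c a < cycPos m c b
  cycLt⇒pos< m c a b a<m c<m (inj₁ (c≤a , a<b))
    rewrite cycPos-≥ m c a c≤a | cycPos-≥ m c b (≤-trans c≤a (<⇒≤ a<b)) = ∸-monoˡ-< a<b c≤a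
  cycLt⇒pos< m c a b a<m c<m (inj₂ (inj₁ (a<b , b<c)))
    rewrite cycPos-< m c a (<-trans a<b b<c) | cycPos-< m c b b<c =
    ∸-monoˡ-< (+-monoˡ-< m a<b) (≤-trans (<⇒≤ c<m) (m≤n+m m a))
  cycLt⇒pos< m c a b a<m c<m (inj₂ (inj₂ (b<c , c≤a)))
    rewrite cycPos-≥ m c a c≤a | cycPos-< m c b b<c =
    ∸-monoˡ-< (<-≤-trans a<m (m≤n+m m b)) c≤a

  cycLt-asym : ∀ {c a b} → CycLt c a b → CycLt c b a → ⊥
  cycLt-asym (inj₁ (_ , a<b)) (inj₁ (_ , b<a)) = <-asym a<b b<a
  cycLt-asym (inj₁ (c≤a , _)) (inj₂ (inj₁ (_ , a<c))) = <⇒≱ a<c c≤a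
  cycLt-asym (inj₁ (c≤a , _)) (inj₂ (inj₂ (a<c , _))) = <⇒≱ a<c c≤a
  cycLt-asym (inj₂ (inj₁ (_ , b<c))) (inj₁ (c≤b , _)) = <⇒≱ b<c c≤b
  cycLt-asym (inj₂ (inj₁ (a<b , _))) (inj₂ (inj₁ (b<a , _))) = <-asym a<b b<a
  cycLt-asym (inj₂ (inj₁ (_ , b<c))) (inj₂ (inj₂ (_ , c≤b))) = <⇒≱ b<c c≤b
  cycLt-asym (inj₂ (inj₂ (b<c , _))) (inj₁ (c≤b , _)) = <⇒≱ b<c c≤b
  cycLt-asym (inj₂ (inj₂ (_ , c≤a))) (inj₂ (inj₁ (_ , a<c))) = <⇒≱ a<c c≤a
  cycLt-asym (inj₂ (inj₂ (b<c , _))) (inj₂ (inj₂ (_ , c≤b))) = <⇒≱ b<c c≤b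

  cycLt-connex : ∀ c a b → a ≢ b → CycLt c a b ⊎ CycLt c b a
  cycLt-connex c a b a≢b with <-cmp a b | c ≤? a | c ≤? b
  ... | tri≈ _ e _ | _ | _ = ⊥-elim (a≢b e)
  ... | tri< a<b _ _ | yes c≤a | _ = inj₁ (inj₁ (c≤a , a<b))
  ... | tri< a<b _ _ | no c≰a | yes c≤b = inj₂ (inj₂ (inj₂ (≰⇒> c≰a , c≤b)))
  ... | tri< a<b _ _ | no c≰a | no c≰b = inj₁ (inj₂ (inj₁ (a<b , ≰⇒> c≰b)))
  ... | tri> _ _ b<a | _ | yes c≤b = inj₂ (inj₁ (c≤b , b<a))
  ... | tri> _ _ b<a | yes c≤a | no c≰b = inj₁ (inj₂ (inj₂ (≰⇒> c≰b , c≤a)))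
  ... | tri> _ _ b<a | no c≰a | no c≰b = inj₂ (inj₂ (inj₁ (b<a , ≰⇒> c≰a)))

  cycLt-first : ∀ {c z} → z ≢ c → CycLt c c z
  cycLt-first {c} {z} z≢c with <-cmp c z
  ... | tri< c<z _ _ = inj₁ (≤-refl , c<z)
  ... | tri≈ _ e _ = ⊥-elim (z≢c (sym e))
  ... | tri> _ _ z<c = inj₂ (inj₂ (z<c , ≤-refl))

  IsNextMod : ℕ → ℕ → ℕ → Set
  IsNextMod m c c' = c' ≡ suc c ⊎ (c' ≡ 0 × suc c ≡ m)

  private
    ≤∧≢⇒suc≤ : ∀ {a c} → c ≤ a → a ≢ c → suc c ≤ a
    ≤∧≢⇒suc≤ c≤a a≢c = ≤∧≢⇒< c≤a (λ e → a≢c (sym e))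

    <suc∧≢⇒< : ∀ {b c} → b < suc c → b ≢ c → b < c
    <suc∧≢⇒< b<sc b≢c = ≤∧≢⇒< (≤-pred b<sc) b≢c

  -- Moving the start point from c to c+1 does not change the relative order
  -- of two elements different from c (in either direction; only the
  -- hypotheses used are stated).
  cycLt-advance : ∀ {m c c' a b} → IsNextMod m c c' → a < m → a ≢ c →
                  CycLt c a b → CycLt c' a b
  cycLt-advance (inj₁ refl) _ a≢c (inj₁ (c≤a , a<b)) = inj₁ (≤∧≢⇒suc≤ c≤a a≢c , a<b)
  cycLt-advance (inj₁ refl) _ _ (inj₂ (inj₁ (a<b , b<c))) = inj₂ (inj₁ (a<b , m<n⇒m<1+n b<c))
  cycLt-advance (inj₁ refl) _ a≢c (inj₂ (inj₂ (b<c , c≤a))) = inj₂ (inj₂ (m<n⇒m<1+n b<c , ≤∧≢⇒suc≤ c≤a a≢c))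
  cycLt-advance (inj₂ (refl , refl)) a<m a≢c (inj₁ (c≤a , _)) = ⊥-elim (a≢c (≤-antisym (≤-pred a<m) c≤a))
  cycLt-advance (inj₂ (refl , refl)) _ _ (inj₂ (inj₁ (a<b , _))) = inj₁ (z≤n , a<b)
  cycLt-advance (inj₂ (refl , refl)) a<m a≢c (inj₂ (inj₂ (_ , c≤a))) = ⊥-elim (a≢c (≤-antisym (≤-pred a<m) c≤a))

  cycLt-retreat : ∀ {m c c' a b} → IsNextMod m c c' → b < m → b ≢ c →
                  CycLt c' a b → CycLt c a b
  cycLt-retreat (inj₁ refl) _ _ (inj₁ (c≤a , a<b)) = inj₁ (≤-trans (n≤1+n _) c≤a , a<b)
  cycLt-retreat (inj₁ refl) _ b≢c (inj₂ (inj₁ (a<b , b<c))) = inj₂ (inj₁ (a<b , <suc∧≢⇒< b<c b≢c))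
  cycLt-retreat (inj₁ refl) _ b≢c (inj₂ (inj₂ (b<c , c≤a))) = inj₂ (inj₂ (<suc∧≢⇒< b<c b≢c , ≤-trans (n≤1+n _) c≤a))
  cycLt-retreat (inj₂ (refl , refl)) b<m b≢c (inj₁ (_ , a<b)) = inj₂ (inj₁ (a<b , <suc∧≢⇒< b<m b≢c))
  cycLt-retreat (inj₂ (refl , refl)) _ _ (inj₂ (inj₁ (_ , ())))
  cycLt-retreat (inj₂ (refl , refl)) _ _ (inj₂ (inj₂ (() , _)))

  cycLt-last : ∀ {m c c' z} → IsNextMod m c c' → z < m → z ≢ c → CycLt c' z c
  cycLt-last {z = z} (inj₁ refl) _ z≢c with <-cmp z _
  ... | tri< z<c _ _ = inj₂ (inj₁ (z<c , n<1+n _))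
  ... | tri≈ _ e _ = ⊥-elim (z≢c e)
  ... | tri> _ _ c<z = inj₂ (inj₂ (n<1+n _ , c<z))
  cycLt-last (inj₂ (refl , refl)) z<m z≢c = inj₁ (z≤n , <suc∧≢⇒< z<m z≢c)

  cycLt-between : ∀ {c a y x} → CycLt c a x → a ≤ y → y < x → CycLt c y x
  cycLt-between (inj₁ (c≤a , _)) a≤y y<x = inj₁ (≤-trans c≤a a≤y , y<x)
  cycLt-between (inj₂ (inj₁ (_ , x<c))) _ y<x = inj₂ (inj₁ (y<x , x<c))
  cycLt-between (inj₂ (inj₂ (x<c , c≤a))) a≤y y<x = inj₂ (inj₂ (x<c , ≤-trans c≤a a≤y))

  -- If a+1 comes before a, the order starts at a+1 and a is its last element.
  cycLt-wrapSuc : ∀ {m c a y} → CycLt c (suc a) a → y < m → y ≢ a → CycLt c y a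
  cycLt-wrapSuc (inj₁ (_ , lt)) _ _ = ⊥-elim (<-asym lt (n<1+n _))
  cycLt-wrapSuc (inj₂ (inj₁ (lt , _))) _ _ = ⊥-elim (<-asym lt (n<1+n _))
  cycLt-wrapSuc {m} {c} {a} {y} (inj₂ (inj₂ (a<c , c≤sa))) y<m y≢a with ≤-antisym c≤sa a<c
  ... | refl = cycLt-last {m} {a} {suc a} {y} (inj₁ refl) y<m y≢a

  cycLt-descent : ∀ {c r x} → r < x → CycLt c x r → r < c × c ≤ x
  cycLt-descent r<x (inj₁ (_ , x<r)) = ⊥-elim (<-asym r<x x<r)
  cycLt-descent r<x (inj₂ (inj₁ (x<r , _))) = ⊥-elim (<-asym r<x x<r)
  cycLt-descent r<x (inj₂ (inj₂ h)) = h

  cycLt? : ∀ c a b → Dec (CycLt c a b)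
  cycLt? c a b = ((c ≤? a) ×-dec (a <? b)) ⊎-dec (((a <? b) ×-dec (b <? c)) ⊎-dec ((b <? c) ×-dec (c ≤? a)))

  nextMod-isNextMod : ∀ {m} (c : Fin m) → IsNextMod m (toℕ c) (toℕ (nextMod c))
  nextMod-isNextMod {suc m} c with suc (toℕ c) <? suc m
  ... | yes lt = inj₁ (trans (FinP.toℕ-fromℕ< _) (m<n⇒m%n≡m lt))
  ... | no ¬lt = inj₂ (trans (FinP.toℕ-fromℕ< _) (trans (cong (_% suc m) 1+c≡m) (n%n≡0 (suc m))) , 1+c≡m)
    where
    1+c≡m : suc (toℕ c) ≡ suc m
    1+c≡m = ≤-antisym (FinP.toℕ<n c) (≮⇒≥ ¬lt)

  nextMod-induction : ∀ {m} (P : Fin (suc m) → Set) → P Fin.zero →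
                      (∀ c → P c → P (nextMod c)) → ∀ c → P c
  nextMod-induction {m} P P0 step c =
    subst P (FinP.fromℕ<-toℕ c (FinP.toℕ<n c)) (upTo (toℕ c) (FinP.toℕ<n c))
    where
    upTo : ∀ k (k<m : k < suc m) → P (Fin.fromℕ< k<m)
    upTo zero _ = P0
    upTo (suc k) 1+k<m = subst P next≡ (step _ (upTo k k<m))
      where
      k<m : k < suc m
      k<m = <-trans (n<1+n k) 1+k<m
      next≡ : nextMod (Fin.fromℕ< k<m) ≡ Fin.fromℕ< 1+k<m
      next≡ with nextMod-isNextMod (Fin.fromℕ< k<m)
      ... | inj₁ e = FinP.toℕ-injective
                       (trans e (trans (cong suc (FinP.toℕ-fromℕ< k<m)) (sym (FinP.toℕ-fromℕ< 1+k<m))))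
      ... | inj₂ (_ , e) = ⊥-elim (<-irrefl (trans (sym (cong suc (FinP.toℕ-fromℕ< k<m))) e) 1+k<m)

module FiniteSums where
  open import Defs using (sumF)
  open import Data.Nat as ℕ using (zero; suc)
  open import Data.Fin as Fin using (Fin; _↑ˡ_; _↑ʳ_)
  import Data.Fin.Properties as FinP
  open import Data.Rational using (ℚ; 0ℚ; _+_; _*_; -_)
  import Data.Rational.Properties as ℚP
  open import Data.Product using (∃; _,_)
  open import Relation.Binary.PropositionalEquality
  open import Relation.Nullary using (yes; no)
  open import Data.Empty using (⊥-elim)
  open import Data.Rational.Solver using (module +-*-Solver)
  open +-*-Solver using (solve; _:+_; _:=_)

  sumF-cong : ∀ {n} {f g : Fin n → ℚ} → (∀ k → f k ≡ g k) → sumF f ≡ sumF g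
  sumF-cong {zero} h = refl
  sumF-cong {suc n} h = cong₂ _+_ (h Fin.zero) (sumF-cong (λ k → h (Fin.suc k)))

  sumF-zero : ∀ {n} {f : Fin n → ℚ} → (∀ k → f k ≡ 0ℚ) → sumF f ≡ 0ℚ
  sumF-zero {zero} h = refl
  sumF-zero {suc n} h rewrite h Fin.zero | sumF-zero {n} (λ k → h (Fin.suc k)) = refl

  sumF-+ : ∀ {n} (f g : Fin n → ℚ) → sumF (λ k → f k + g k) ≡ sumF f + sumF g
  sumF-+ {zero} f g = refl
  sumF-+ {suc n} f g rewrite sumF-+ (λ k → f (Fin.suc k)) (λ k → g (Fin.suc k)) =
    solve 4 (λ a b c d → (a :+ b) :+ (c :+ d) := (a :+ c) :+ (b :+ d)) refl
      (f Fin.zero) (g Fin.zero) (sumF (λ k → f (Fin.suc k))) (sumF (λ k → g (Fin.suc k)))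

  sumF-* : ∀ {n} (a : ℚ) (f : Fin n → ℚ) → sumF (λ k → a * f k) ≡ a * sumF f
  sumF-* {zero} a f = sym (ℚP.*-zeroʳ a)
  sumF-* {suc n} a f rewrite sumF-* a (λ k → f (Fin.suc k)) = sym (ℚP.*-distribˡ-+ a (f Fin.zero) _)

  sumF-neg : ∀ {n} (f : Fin n → ℚ) → sumF (λ k → - f k) ≡ - sumF f
  sumF-neg {zero} f = refl
  sumF-neg {suc n} f rewrite sumF-neg (λ k → f (Fin.suc k)) = sym (ℚP.neg-distrib-+ (f Fin.zero) _)

  sumF-single : ∀ {n} (f : Fin n → ℚ) (a : Fin n) → (∀ k → k ≢ a → f k ≡ 0ℚ) → sumF f ≡ f a
  sumF-single {suc n} f Fin.zero h
    rewrite sumF-zero {n} {λ k → f (Fin.suc k)} (λ k → h (Fin.suc k) (λ ())) = ℚP.+-identityʳ _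
  sumF-single {suc n} f (Fin.suc a) h
    rewrite h Fin.zero (λ ())
          | sumF-single (λ k → f (Fin.suc k)) a (λ k k≢a → h (Fin.suc k) (λ e → k≢a (FinP.suc-injective e)))
    = ℚP.+-identityˡ _

  sumF-split : ∀ n m (f : Fin (n ℕ.+ m) → ℚ) →
               sumF f ≡ sumF (λ k → f (k ↑ˡ m)) + sumF (λ k → f (n ↑ʳ k))
  sumF-split zero m f = sym (ℚP.+-identityˡ _)
  sumF-split (suc n) m f rewrite sumF-split n m (λ k → f (Fin.suc k)) =
    sym (ℚP.+-assoc (f Fin.zero) (sumF (λ k → f (Fin.suc (k ↑ˡ m)))) (sumF (λ k → f (Fin.suc (n ↑ʳ k)))))

  sumF-swap : ∀ {n m} (f : Fin n → Fin m → ℚ) →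
              sumF (λ k → sumF (λ y → f k y)) ≡ sumF (λ y → sumF (λ k → f k y))
  sumF-swap {zero} {m} f = sym (sumF-zero {m} (λ _ → refl))
  sumF-swap {suc n} {m} f rewrite sumF-swap (λ k y → f (Fin.suc k) y) =
    sym (sumF-+ (λ y → f Fin.zero y) (λ y → sumF (λ k → f (Fin.suc k) y)))

  sumF-nonzero : ∀ {n} (f : Fin n → ℚ) → sumF f ≢ 0ℚ → ∃ λ k → f k ≢ 0ℚ
  sumF-nonzero {zero} f h = ⊥-elim (h refl)
  sumF-nonzero {suc n} f h with f Fin.zero ℚP.≟ 0ℚ
  ... | no ne = Fin.zero , ne
  ... | yes e with sumF-nonzero (λ k → f (Fin.suc k)) (λ e' → h (cong₂ _+_ e e'))
  ...   | k , ne = Fin.suc k , ne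

module Subsets where
  open import Data.Nat using (zero; suc; _+_)
  open import Data.Bool using (true)
  open import Data.Fin as Fin using (Fin; _↑ˡ_; _↑ʳ_)
  open import Data.Fin.Subset
  open import Data.Fin.Subset.Properties using (_∈?_; ⊆-antisym; p⊂q⇒∣p∣<∣q∣; p─⊥≡p; p─q⊆p; ∪-identityʳ; Empty-unique; ∣⊥∣≡0; drop-there)
  open import Data.Product using (_,_)
  open import Data.Vec using (_∷_; tabulate)
  open import Data.Vec.Properties using ([]=⇒lookup; lookup⇒[]=; lookup∘tabulate)
  open import Data.Vec.Base using (here; there)
  open import Relation.Binary.PropositionalEquality
  import Data.Nat.Properties as ℕP
  open import Relation.Nullary using (yes; no; Dec; does)
  open import Data.Empty using (⊥-elim)

  fromDec : ∀ {m} {P : Fin m → Set} → (∀ x → Dec (P x)) → Subset m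
  fromDec P? = tabulate (λ x → does (P? x))

  ∈-fromDec⁺ : ∀ {m} {P : Fin m → Set} (P? : ∀ x → Dec (P x)) {x} → P x → x ∈ fromDec P?
  ∈-fromDec⁺ {P = P} P? {x} px = lookup⇒[]= x _ (trans (lookup∘tabulate (λ y → does (P? y)) x) (decide (P? x)))
    where
    decide : (d : Dec (P x)) → does d ≡ true
    decide (yes _) = refl
    decide (no ¬px) = ⊥-elim (¬px px)

  ∈-fromDec⁻ : ∀ {m} {P : Fin m → Set} (P? : ∀ x → Dec (P x)) {x} → x ∈ fromDec P? → P x
  ∈-fromDec⁻ {P = P} P? {x} x∈ = decide (P? x) (trans (sym (lookup∘tabulate (λ y → does (P? y)) x)) ([]=⇒lookup x∈))
    where
    decide : (d : Dec (P x)) → does d ≡ true → P x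
    decide (yes px) _ = px
    decide (no _) ()

  x∉p-x : ∀ {m} (p : Subset m) x → x ∉ p - x
  x∉p-x (inside ∷ p) Fin.zero ()
  x∉p-x (outside ∷ p) Fin.zero ()
  x∉p-x (inside ∷ p) (Fin.suc x) (there h) = x∉p-x p x h
  x∉p-x (outside ∷ p) (Fin.suc x) (there h) = x∉p-x p x h

  x∈p-y⇒x≢y : ∀ {m} {p : Subset m} {x y} → x ∈ p - y → x ≢ y
  x∈p-y⇒x≢y {p = p} {x} x∈ refl = x∉p-x p x x∈

  x∈p-y⇒x∈p : ∀ {m} {p : Subset m} {x y} → x ∈ p - y → x ∈ p
  x∈p-y⇒x∈p {p = p} {y = y} = p─q⊆p p ⁅ y ⁆

  ∣p∣≡1+∣p-x∣ : ∀ {m} (p : Subset m) x → x ∈ p → ∣ p ∣ ≡ suc ∣ p - x ∣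
  ∣p∣≡1+∣p-x∣ (inside ∷ p) Fin.zero here = cong suc (cong ∣_∣ (sym (p─⊥≡p p)))
  ∣p∣≡1+∣p-x∣ (inside ∷ p) (Fin.suc x) (there h) = cong suc (∣p∣≡1+∣p-x∣ p x h)
  ∣p∣≡1+∣p-x∣ (outside ∷ p) (Fin.suc x) (there h) = ∣p∣≡1+∣p-x∣ p x h

  ∣p∪⁅y⁆∣≡1+∣p∣ : ∀ {m} (p : Subset m) y → y ∉ p → ∣ p ∪ ⁅ y ⁆ ∣ ≡ suc ∣ p ∣
  ∣p∪⁅y⁆∣≡1+∣p∣ (inside ∷ p) Fin.zero y∉p = ⊥-elim (y∉p here)
  ∣p∪⁅y⁆∣≡1+∣p∣ (outside ∷ p) Fin.zero _ = cong (λ s → suc ∣ s ∣) (∪-identityʳ p)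
  ∣p∪⁅y⁆∣≡1+∣p∣ (inside ∷ p) (Fin.suc y) y∉p = cong suc (∣p∪⁅y⁆∣≡1+∣p∣ p y (λ h → y∉p (there h)))
  ∣p∪⁅y⁆∣≡1+∣p∣ (outside ∷ p) (Fin.suc y) y∉p = ∣p∪⁅y⁆∣≡1+∣p∣ p y (λ h → y∉p (there h))

  ⊆-sameSize⇒≡ : ∀ {m} {p q : Subset m} → p ⊆ q → ∣ p ∣ ≡ ∣ q ∣ → p ≡ q
  ⊆-sameSize⇒≡ {p = p} {q} p⊆q ∣p∣≡∣q∣ = ⊆-antisym p⊆q q⊆p
    where
    q⊆p : q ⊆ p
    q⊆p {x} x∈q with x ∈? p
    ... | yes x∈p = x∈p
    ... | no x∉p = ⊥-elim (ℕP.<-irrefl ∣p∣≡∣q∣ (p⊂q⇒∣p∣<∣q∣ (p⊆q , x , x∈q , x∉p)))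

  ∣exchange∣ : ∀ {m} (p : Subset m) {x y} → x ∈ p → y ∉ p → ∣ (p - x) ∪ ⁅ y ⁆ ∣ ≡ ∣ p ∣
  ∣exchange∣ p {x} {y} x∈p y∉p = begin
    ∣ (p - x) ∪ ⁅ y ⁆ ∣  ≡⟨ ∣p∪⁅y⁆∣≡1+∣p∣ (p - x) y (λ y∈ → y∉p (x∈p-y⇒x∈p y∈)) ⟩
    suc ∣ p - x ∣        ≡⟨ sym (∣p∣≡1+∣p-x∣ p x x∈p) ⟩
    ∣ p ∣                ∎
    where open ≡-Reasoning

  ∣firstBlock∣ : ∀ a {b} (S : Subset (a + b)) → (∀ k → k ↑ˡ b ∈ S) → (∀ k → a ↑ʳ k ∉ S) → ∣ S ∣ ≡ a
  ∣firstBlock∣ zero {b} S _ none = trans (cong ∣_∣ (Empty-unique (λ (x , x∈) → none x x∈))) (∣⊥∣≡0 b)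
  ∣firstBlock∣ (suc a) (inside ∷ S) first notLast =
    cong suc (∣firstBlock∣ a S (λ k → drop-there (first (Fin.suc k))) (λ k k∈ → notLast k (there k∈)))
  ∣firstBlock∣ (suc a) (outside ∷ S) first _ with first Fin.zero
  ... | ()

module Columns where
  open import Defs using (sumF; LinIndepCols; sign)
  open import Data.Fin.Subset using (Subset; _∈_; _∉_)
  open import Data.Fin.Subset.Properties using (_∈?_)
  open FiniteSums
  open import Data.Nat using (ℕ; zero; suc)
  open import Data.Fin as Fin using (Fin)
  open import Data.Rational using (ℚ; 0ℚ; 1ℚ; _+_; _*_; -_)
  import Data.Rational.Properties as ℚP
  open import Data.Bool using (if_then_else_)
  open import Relation.Binary.PropositionalEquality
  open import Relation.Nullary using (yes; no; does)
  open import Data.Empty using (⊥-elim)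
  open import Data.Rational.Solver using (module +-*-Solver)
  open +-*-Solver using (solve; _:*_; :-_; _:=_)

  δ : ∀ {m} → Fin m → Fin m → ℚ
  δ a k = if does (k Fin.≟ a) then 1ℚ else 0ℚ

  δ-same : ∀ {m} (a : Fin m) → δ a a ≡ 1ℚ
  δ-same a with a Fin.≟ a
  ... | yes _ = refl
  ... | no a≢a = ⊥-elim (a≢a refl)

  δ-diff : ∀ {m} {a k : Fin m} → k ≢ a → δ a k ≡ 0ℚ
  δ-diff {a = a} {k} k≢a with k Fin.≟ a
  ... | yes k≡a = ⊥-elim (k≢a k≡a)
  ... | no _ = refl

  _⊖_ : ∀ {m} → (Fin m → ℚ) → (Fin m → ℚ) → Fin m → ℚ
  (u ⊖ v) x = u x + - v x

  _⊙_ : ∀ {m} → ℚ → (Fin m → ℚ) → Fin m → ℚ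
  (a ⊙ u) x = a * u x

  ⊙-support : ∀ {m} a (u : Fin m → ℚ) x → (a ⊙ u) x ≢ 0ℚ → u x ≢ 0ℚ
  ⊙-support a u x nz e = nz (trans (cong (a *_) e) (ℚP.*-zeroʳ a))

  ⊙-normalise : ∀ {m} s (u : Fin m → ℚ) x → s * s ≡ 1ℚ → u x ≡ - s → ((- s) ⊙ u) x ≡ 1ℚ
  ⊙-normalise s u x s²≡1 ux≡-s =
    trans (cong ((- s) *_) ux≡-s) (trans (solve 1 (λ a → (:- a) :* (:- a) := a :* a) refl s) s²≡1)

  sign² : ∀ k → sign k * sign k ≡ 1ℚ
  sign² zero = refl
  sign² (suc k) = trans (solve 1 (λ s → (:- s) :* (:- s) := s :* s) refl (sign k)) (sign² k)

  module Combination {n m : ℕ} (M : Fin n → Fin m → ℚ) where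

    comb : (Fin m → ℚ) → Fin n → ℚ
    comb v r = sumF (λ k → v k * M r k)

    InKernel : (Fin m → ℚ) → Set
    InKernel v = ∀ r → comb v r ≡ 0ℚ

    comb-δ : ∀ x r → comb (δ x) r ≡ M r x
    comb-δ x r = begin
      sumF (λ k → δ x k * M r k)
        ≡⟨ sumF-single (λ k → δ x k * M r k) x
             (λ k k≢x → trans (cong (_* M r k) (δ-diff k≢x)) (ℚP.*-zeroˡ (M r k))) ⟩
      δ x x * M r x            ≡⟨ cong (_* M r x) (δ-same x) ⟩
      1ℚ * M r x               ≡⟨ ℚP.*-identityˡ _ ⟩
      M r x                    ∎
      where open ≡-Reasoning

    comb-⊖ : ∀ u v r → comb (u ⊖ v) r ≡ comb u r + - comb v r
    comb-⊖ u v r = begin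
      sumF (λ k → (u k + - v k) * M r k)
        ≡⟨ sumF-cong (λ k → trans (ℚP.*-distribʳ-+ (M r k) (u k) (- v k))
                                   (cong (u k * M r k +_) (sym (ℚP.neg-distribˡ-* (v k) (M r k))))) ⟩
      sumF (λ k → u k * M r k + - (v k * M r k))
        ≡⟨ sumF-+ (λ k → u k * M r k) (λ k → - (v k * M r k)) ⟩
      comb u r + sumF (λ k → - (v k * M r k))
        ≡⟨ cong (comb u r +_) (sumF-neg (λ k → v k * M r k)) ⟩
      comb u r + - comb v r ∎
      where open ≡-Reasoning

    comb-⊙ : ∀ a u r → comb (a ⊙ u) r ≡ a * comb u r
    comb-⊙ a u r = trans (sumF-cong (λ k → ℚP.*-assoc a (u k) (M r k))) (sumF-* a (λ k → u k * M r k))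

    comb-Σ : ∀ {l} (a : Fin l → ℚ) (v : Fin l → Fin m → ℚ) r →
             comb (λ k → sumF (λ y → a y * v y k)) r ≡ sumF (λ y → a y * comb (v y) r)
    comb-Σ a v r = begin
      sumF (λ k → sumF (λ y → a y * v y k) * M r k)
        ≡⟨ sumF-cong (λ k → trans (ℚP.*-comm (sumF (λ y → a y * v y k)) (M r k))
                                   (sym (sumF-* (M r k) (λ y → a y * v y k)))) ⟩
      sumF (λ k → sumF (λ y → M r k * (a y * v y k)))
        ≡⟨ sumF-swap (λ k y → M r k * (a y * v y k)) ⟩
      sumF (λ y → sumF (λ k → M r k * (a y * v y k)))
        ≡⟨ sumF-cong (λ y → trans (sumF-cong (λ k → rearrange (M r k) (a y) (v y k)))
                                   (sumF-* (a y) (λ k → v y k * M r k))) ⟩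
      sumF (λ y → a y * comb (v y) r) ∎
      where
      open ≡-Reasoning
      rearrange : ∀ A B C → A * (B * C) ≡ B * (C * A)
      rearrange = solve 3 (λ A B C → A :* (B :* C) := B :* (C :* A)) refl

    ⊖-inKernel : ∀ {u v} → InKernel u → InKernel v → InKernel (u ⊖ v)
    ⊖-inKernel {u} {v} ku kv r =
      trans (comb-⊖ u v r) (trans (cong₂ (λ a b → a + - b) (ku r) (kv r)) (ℚP.+-inverseʳ 0ℚ))

    ⊙-inKernel : ∀ a {u} → InKernel u → InKernel (a ⊙ u)
    ⊙-inKernel a {u} ku r = trans (comb-⊙ a u r) (trans (cong (a *_) (ku r)) (ℚP.*-zeroʳ a))

    Annihilates : (Fin m → ℚ) → Set
    Annihilates φ = ∀ w → InKernel w → sumF (λ k → w k * φ k) ≡ 0ℚ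

    row-annihilates : ∀ ρ → Annihilates (M ρ)
    row-annihilates ρ w w-ker = w-ker ρ

    rows-annihilate : ∀ ρ ρ' → Annihilates (λ k → M ρ k + M ρ' k)
    rows-annihilate ρ ρ' w w-ker =
      trans (sumF-cong (λ k → ℚP.*-distribˡ-+ (w k) (M ρ k) (M ρ' k)))
            (trans (sumF-+ (λ k → w k * M ρ k) (λ k → w k * M ρ' k)) (cong₂ _+_ (w-ker ρ) (w-ker ρ')))

    -- Exchange: if a functional φ annihilating the kernel vanishes on S'
    -- except at j, where it is ±1, and S' without j lies in the independent
    -- set S, then S' is independent (a dependency on S' cannot involve j).
    independent-exchange : ∀ {S S' : Subset m} j φ → Annihilates φ →
      (∀ k → k ∈ S' → k ≢ j → φ k ≡ 0ℚ) → φ j * φ j ≡ 1ℚ →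
      (∀ k → k ∈ S' → k ≢ j → k ∈ S) → LinIndepCols M S → LinIndepCols M S'
    independent-exchange {S} {S'} j φ φ-ann φ-vanish φj² S'⊆S S-indep w w-support w-ker =
      S-indep w w-support' w-ker
      where
      term : ∀ k → k ≢ j → w k * φ k ≡ 0ℚ
      term k k≢j with k ∈? S'
      ... | yes k∈ = trans (cong (w k *_) (φ-vanish k k∈ k≢j)) (ℚP.*-zeroʳ (w k))
      ... | no k∉ = trans (cong (_* φ k) (w-support k k∉)) (ℚP.*-zeroˡ (φ k))
      wj*φj≡0 : w j * φ j ≡ 0ℚ
      wj*φj≡0 = trans (sym (sumF-single (λ k → w k * φ k) j term)) (φ-ann w w-ker)
      wj≡0 : w j ≡ 0ℚ
      wj≡0 = begin
        w j                  ≡⟨ sym (ℚP.*-identityʳ (w j)) ⟩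
        w j * 1ℚ             ≡⟨ cong (w j *_) (sym φj²) ⟩
        w j * (φ j * φ j)    ≡⟨ sym (ℚP.*-assoc (w j) (φ j) (φ j)) ⟩
        (w j * φ j) * φ j    ≡⟨ cong (_* φ j) wj*φj≡0 ⟩
        0ℚ * φ j             ≡⟨ ℚP.*-zeroˡ (φ j) ⟩
        0ℚ                   ∎
        where open ≡-Reasoning
      w-support' : ∀ k → k ∉ S → w k ≡ 0ℚ
      w-support' k k∉S with k Fin.≟ j
      ... | yes refl = wj≡0
      ... | no k≢j with k ∈? S'
      ...   | yes k∈S' = ⊥-elim (k∉S (S'⊆S k k∈S' k≢j))
      ...   | no k∉S' = w-support k k∉S'

module CyclicSorting where
  open import Defs using (orderFrom; sortedFrom; posFrom; LexLt)
  open CyclicOrder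
  open import Data.Nat as ℕ using (ℕ; zero; suc; _≤_; _<_)
  import Data.Nat.Properties as ℕP
  open import Data.Fin as Fin using (Fin; toℕ)
  import Data.Fin.Properties as FinP
  open import Data.Fin.Subset using (_∈_)
  open import Data.Fin.Subset.Properties using (_∈?_)
  open import Data.List using ([]; _∷_; drop; take; allFin; tabulate)
  open import Data.List.Properties using (take++drop≡id)
  open import Data.List.Membership.Propositional using () renaming (_∈_ to _∈ˡ_)
  open import Data.List.Membership.Propositional.Properties using (∈-filter⁺; ∈-filter⁻; ∈-++⁺ˡ; ∈-++⁺ʳ; ∈-++⁻; ∈-allFin)
  open import Data.List.Relation.Unary.Any using (here; there)
  open import Data.List.Relation.Unary.All as All using (All; []; _∷_)
  import Data.List.Relation.Unary.All.Properties as AllP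
  open import Data.List.Relation.Unary.AllPairs using (AllPairs; []; _∷_)
  import Data.List.Relation.Unary.AllPairs.Properties as AllPairsP
  open import Data.Product using (Σ; _×_; _,_; proj₂)
  open import Data.Sum using (_⊎_; inj₁; inj₂)
  open import Relation.Binary.PropositionalEquality
  open import Relation.Nullary using (¬_; yes; no; Dec)
  open import Data.Empty using (⊥-elim)
  open import Relation.Binary.Definitions using (tri<; tri≈; tri>)

  -- The lists `orderFrom c` and `sortedFrom c S` of Defs are strictly sorted
  -- by the cyclic position from c, which turns the lexicographic comparison
  -- `LexLt` into statements about subsets.

  dropBound : ∀ {m M} (f : Fin m → Fin M) d → (∀ i → toℕ (f i) ≡ d ℕ.+ toℕ i) →
              ∀ k → All (λ x → d ℕ.+ k ≤ toℕ x) (drop k (tabulate f))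
  dropBound {zero} f d h k = AllP.drop⁺ k []
  dropBound {suc m} f d h zero =
    AllP.tabulate⁺ (λ i → subst (d ℕ.+ 0 ≤_) (sym (h i)) (ℕP.+-monoʳ-≤ d ℕ.z≤n))
  dropBound {suc m} f d h (suc k) =
    All.map (λ {x} le → subst (_≤ toℕ x) (sym (ℕP.+-suc d k)) le)
      (dropBound (λ i → f (Fin.suc i)) (suc d) (λ i → trans (h (Fin.suc i)) (ℕP.+-suc d (toℕ i))) k)

  takeBound : ∀ {m M} (f : Fin m → Fin M) d → (∀ i → toℕ (f i) ≡ d ℕ.+ toℕ i) →
              ∀ k → All (λ x → toℕ x < d ℕ.+ k) (take k (tabulate f))
  takeBound {zero} f d h k = AllP.take⁺ k []
  takeBound {suc m} f d h zero = []
  takeBound {suc m} f d h (suc k) =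
    subst (_< d ℕ.+ suc k) (sym (h Fin.zero)) (ℕP.+-monoʳ-< d (ℕ.s≤s ℕ.z≤n))
    ∷ All.map (λ {x} le → subst (toℕ x <_) (sym (ℕP.+-suc d k)) le)
        (takeBound (λ i → f (Fin.suc i)) (suc d) (λ i → trans (h (Fin.suc i)) (ℕP.+-suc d (toℕ i))) k)

  AllPairs-strengthen : ∀ {A : Set} {P : A → Set} {Q R : A → A → Set} {xs} →
    All P xs → AllPairs Q xs → (∀ {a b} → P a → P b → Q a b → R a b) → AllPairs R xs
  AllPairs-strengthen [] [] f = []
  AllPairs-strengthen (pa ∷ pas) (qa ∷ qas) f =
    All.zipWith (λ (pb , q) → f pa pb q) (pas , qa) ∷ AllPairs-strengthen pas qas f

  module SortedFrom {m : ℕ} (c : Fin m) where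

    pos : Fin m → ℕ
    pos = posFrom c

    _≺c_ : Fin m → Fin m → Set
    a ≺c b = pos a < pos b

    _≺c?_ : ∀ a b → Dec (a ≺c b)
    a ≺c? b = pos a ℕP.<? pos b

    cycLt⇒≺c : ∀ {a b} → CycLt (toℕ c) (toℕ a) (toℕ b) → a ≺c b
    cycLt⇒≺c {a} {b} = cycLt⇒pos< m (toℕ c) (toℕ a) (toℕ b) (FinP.toℕ<n a) (FinP.toℕ<n c)

    pos-injective : ∀ {a b} → pos a ≡ pos b → a ≡ b
    pos-injective {a} {b} e with a Fin.≟ b
    ... | yes a≡b = a≡b
    ... | no a≢b with cycLt-connex (toℕ c) (toℕ a) (toℕ b) (λ t → a≢b (FinP.toℕ-injective t))
    ...   | inj₁ h = ⊥-elim (ℕP.<-irrefl e (cycLt⇒≺c h))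
    ...   | inj₂ h = ⊥-elim (ℕP.<-irrefl (sym e) (cycLt⇒≺c h))

    orderFrom-sorted : AllPairs _≺c_ (orderFrom c)
    orderFrom-sorted = AllPairsP.++⁺
      (AllPairs-strengthen (dropBound id 0 (λ _ → refl) (toℕ c)) (AllPairsP.drop⁺ (toℕ c) allFin-sorted)
        (λ c≤a _ a<b → cycLt⇒≺c (inj₁ (c≤a , a<b))))
      (AllPairs-strengthen (takeBound id 0 (λ _ → refl) (toℕ c)) (AllPairsP.take⁺ (toℕ c) allFin-sorted)
        (λ _ b<c a<b → cycLt⇒≺c (inj₂ (inj₁ (a<b , b<c)))))
      (All.map (λ c≤a → All.map (λ b<c → cycLt⇒≺c (inj₂ (inj₂ (b<c , c≤a))))
                                (takeBound id 0 (λ _ → refl) (toℕ c)))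
               (dropBound id 0 (λ _ → refl) (toℕ c)))
      where
      id : Fin m → Fin m
      id x = x
      allFin-sorted : AllPairs (λ a b → toℕ a < toℕ b) (allFin m)
      allFin-sorted = AllPairsP.tabulate⁺-< (λ lt → lt)

    sortedFrom-sorted : ∀ S → AllPairs _≺c_ (sortedFrom c S)
    sortedFrom-sorted S = AllPairsP.filter⁺ (_∈? S) orderFrom-sorted

    ∈-orderFrom : ∀ x → x ∈ˡ orderFrom c
    ∈-orderFrom x with ∈-++⁻ (take (toℕ c) (allFin m))
                       (subst (x ∈ˡ_) (sym (take++drop≡id (toℕ c) (allFin m))) (∈-allFin x))
    ... | inj₁ t = ∈-++⁺ʳ (drop (toℕ c) (allFin m)) t
    ... | inj₂ d = ∈-++⁺ˡ d

    ∈-sortedFrom⁺ : ∀ {S x} → x ∈ S → x ∈ˡ sortedFrom c S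
    ∈-sortedFrom⁺ {S} {x} x∈S = ∈-filter⁺ (_∈? S) (∈-orderFrom x) x∈S

    ∈-sortedFrom⁻ : ∀ {S x} → x ∈ˡ sortedFrom c S → x ∈ S
    ∈-sortedFrom⁻ {S} h = proj₂ (∈-filter⁻ (_∈? S) {xs = orderFrom c} h)

    -- Two lists neither of which is lexicographically smaller than the other
    -- are prefix-comparable, hence one is contained in the other.
    lexIncomparable⇒nested : ∀ xs ys → ¬ LexLt c xs ys → ¬ LexLt c ys xs →
      (∀ {z} → z ∈ˡ xs → z ∈ˡ ys) ⊎ (∀ {z} → z ∈ˡ ys → z ∈ˡ xs)
    lexIncomparable⇒nested [] ys _ _ = inj₁ (λ ())
    lexIncomparable⇒nested (x ∷ xs) [] _ _ = inj₂ (λ ())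
    lexIncomparable⇒nested (x ∷ xs) (y ∷ ys) ¬xs<ys ¬ys<xs with ℕP.<-cmp (pos x) (pos y)
    ... | tri< lt _ _ = ⊥-elim (¬xs<ys (LexLt.here lt))
    ... | tri> _ _ gt = ⊥-elim (¬ys<xs (LexLt.here gt))
    ... | tri≈ _ e _ with pos-injective e
    ... | refl with lexIncomparable⇒nested xs ys (λ l → ¬xs<ys (LexLt.there l)) (λ l → ¬ys<xs (LexLt.there l))
    ...   | inj₁ sub = inj₁ (λ { (here refl) → here refl ; (there z∈) → there (sub z∈) })
    ...   | inj₂ sub = inj₂ (λ { (here refl) → here refl ; (there z∈) → there (sub z∈) })

    firstDifference : ∀ {xs ys} → AllPairs _≺c_ xs → AllPairs _≺c_ ys → LexLt c xs ys →
      Σ (Fin m) λ x → x ∈ˡ xs × ¬ x ∈ˡ ys × (∀ z → z ≺c x → z ∈ˡ ys → z ∈ˡ xs)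
    firstDifference {x ∷ _} {y ∷ ys} _ (y≺ys ∷ _) (LexLt.here x≺y) =
      x , here refl , (λ x∈ → noneBefore x∈ ℕP.≤-refl) , (λ z z≺x z∈ → ⊥-elim (noneBefore z∈ (ℕP.<⇒≤ z≺x)))
      where
      -- every element of y ∷ ys is at least y, which is after x
      noneBefore : ∀ {z} → z ∈ˡ y ∷ ys → ¬ (pos z ℕ.≤ pos x)
      noneBefore (here refl) z≤x = ℕP.<⇒≱ x≺y z≤x
      noneBefore (there z∈) z≤x = ℕP.<⇒≱ (ℕP.<-trans x≺y (All.lookup y≺ys z∈)) z≤x
    firstDifference {x ∷ _} (x≺xs ∷ xs-sorted) (_ ∷ ys-sorted) (LexLt.there l)
      with firstDifference xs-sorted ys-sorted l
    ... | d , d∈ , d∉ , below = d , there d∈ , d∉' , below'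
      where
      x≺d : x ≺c d
      x≺d = All.lookup x≺xs d∈
      d∉' : ¬ d ∈ˡ _
      d∉' (here refl) = ℕP.<-irrefl refl x≺d
      d∉' (there d∈ys) = d∉ d∈ys
      below' : ∀ z → z ≺c d → z ∈ˡ _ → z ∈ˡ _
      below' z _ (here refl) = here refl
      below' z z≺d (there z∈) = there (below z z≺d z∈)

module LexMin where
  open import Defs using (sumF; LinIndepCols; IsBasis; LexLt; sortedFrom)
  open FiniteSums
  open Columns
  open CyclicSorting
  open Subsets using (⊆-sameSize⇒≡)
  open import Data.Nat as ℕ using (ℕ; suc)
  import Data.Nat.Properties as ℕP
  open import Data.Fin as Fin using (Fin)
  open import Data.Fin.Subset using (Subset; _∈_; _∉_)
  open import Data.Fin.Subset.Properties using (_∈?_)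
  open import Data.Rational using (ℚ; 0ℚ; 1ℚ; _+_; _*_; -_)
  import Data.Rational.Properties as ℚP
  open import Data.Product using (Σ; _×_; _,_; proj₁; proj₂)
  open import Data.Sum using (_⊎_; inj₁; inj₂)
  open import Relation.Binary.PropositionalEquality
  open import Relation.Nullary using (¬_; yes; no)
  open import Data.Empty using (⊥; ⊥-elim)

  -- A general criterion for lexicographic minimality of a basis of the
  -- column matroid of a matrix M, with respect to the cyclic order from c:
  -- if every column outside G is a combination of earlier columns
  -- ("G is greedy"), then no basis is lexicographically smaller than G,
  -- and a basis G is the only lexicographically minimal basis.

  module GreedyBasis {n m : ℕ} (M : Fin n → Fin m → ℚ) (c : Fin m) where
    open Combination M
    open SortedFrom c

    AtOrBefore : Fin m → Fin m → Set
    AtOrBefore k x = k ≡ x ⊎ k ≺c x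

    -- a kernel vector expressing column x through columns before it
    EarlierDependency : Fin m → Set
    EarlierDependency x =
      Σ (Fin m → ℚ) λ w → InKernel w × w x ≡ 1ℚ × (∀ k → w k ≢ 0ℚ → AtOrBefore k x)

    Greedy : Subset m → Set
    Greedy G = ∀ x → x ∉ G → EarlierDependency x

    SpannedBefore : Subset m → Fin m → Set
    SpannedBefore G x = Σ (Fin m → ℚ) λ v → (∀ r → comb v r ≡ M r x) ×
                                             (∀ k → v k ≢ 0ℚ → k ∈ G × AtOrBefore k x)

    module _ (G : Subset m) (greedy : Greedy G) where

      substituteEarlier : ∀ x (a : Fin m → ℚ) → (∀ r → comb a r ≡ M r x) →
        (∀ y → a y ≢ 0ℚ → y ≺c x) → (∀ y → y ≺c x → SpannedBefore G y) → SpannedBefore G x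
      substituteEarlier x a comb-a a-early spanned = v , comb-v , v-support
        where
        vy : Fin m → Fin m → ℚ
        vy y with y ≺c? x
        ... | yes y≺x = proj₁ (spanned y y≺x)
        ... | no _ = λ _ → 0ℚ
        v : Fin m → ℚ
        v k = sumF (λ y → a y * vy y k)
        comb-vy : ∀ y r → a y * comb (vy y) r ≡ a y * M r y
        comb-vy y r with a y ℚP.≟ 0ℚ
        ... | yes e rewrite e = trans (ℚP.*-zeroˡ (comb (vy y) r)) (sym (ℚP.*-zeroˡ (M r y)))
        ... | no nz with y ≺c? x
        ...   | yes y≺x = cong (a y *_) (proj₁ (proj₂ (spanned y y≺x)) r)
        ...   | no y⊀x = ⊥-elim (y⊀x (a-early y nz))
        comb-v : ∀ r → comb v r ≡ M r x
        comb-v r = begin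
          comb v r                           ≡⟨ comb-Σ a vy r ⟩
          sumF (λ y → a y * comb (vy y) r)   ≡⟨ sumF-cong (λ y → comb-vy y r) ⟩
          comb a r                           ≡⟨ comb-a r ⟩
          M r x                              ∎
          where open ≡-Reasoning
        vy-support : ∀ y k → vy y k ≢ 0ℚ → k ∈ G × k ≺c x
        vy-support y k nz with y ≺c? x
        ... | no _ = ⊥-elim (nz refl)
        ... | yes y≺x with proj₂ (proj₂ (spanned y y≺x)) k nz
        ...   | k∈G , inj₁ refl = k∈G , y≺x
        ...   | k∈G , inj₂ k≺y = k∈G , ℕP.<-trans k≺y y≺x
        v-support : ∀ k → v k ≢ 0ℚ → k ∈ G × AtOrBefore k x
        v-support k nz with sumF-nonzero (λ y → a y * vy y k) nz
        ... | y , nzy with vy-support y k (λ e → nzy (trans (cong (a y *_) e) (ℚP.*-zeroʳ (a y))))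
        ...   | k∈G , k≺x = k∈G , inj₂ k≺x

      -- every column is spanned by earlier columns of G; by induction on its
      -- position, replacing a column outside G by its earlier dependency
      spannedBefore : ∀ x → SpannedBefore G x
      spannedBefore x = below (suc (pos x)) x (ℕP.n<1+n (pos x))
        where
        below : ∀ b x → pos x ℕ.< b → SpannedBefore G x
        below b x _ with x ∈? G
        below b x _ | yes x∈G = δ x , comb-δ x , unitSupport
          where
          unitSupport : ∀ k → δ x k ≢ 0ℚ → k ∈ G × AtOrBefore k x
          unitSupport k nz with k Fin.≟ x
          ... | yes refl = x∈G , inj₁ refl
          ... | no _ = ⊥-elim (nz refl)
        below (suc b) x x<b | no x∉G with greedy x x∉G
        ... | w , w-ker , w-x , w-early =
          substituteEarlier x (δ x ⊖ w) comb-a a-early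
            (λ y y≺x → below b y (ℕP.<-≤-trans y≺x (ℕP.≤-pred x<b)))
          where
          comb-a : ∀ r → comb (δ x ⊖ w) r ≡ M r x
          comb-a r = trans (comb-⊖ (δ x) w r)
                       (trans (cong₂ (λ u v → u + - v) (comb-δ x r) (w-ker r)) (ℚP.+-identityʳ _))
          a-early : ∀ y → (δ x ⊖ w) y ≢ 0ℚ → y ≺c x
          a-early y nz with y Fin.≟ x
          ... | yes refl = ⊥-elim (nz (trans (cong (λ v → 1ℚ + - v) w-x) (ℚP.+-inverseʳ 1ℚ)))
          ... | no y≢x with w-early y (λ e → nz (cong (λ v → 0ℚ + - v) e))
          ...   | inj₁ y≡x = ⊥-elim (y≢x y≡x)
          ...   | inj₂ y≺x = y≺x

      -- An independent set J cannot contain a column x ∉ G together with all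
      -- columns of G before x: x would be spanned by them.
      noEarlierIndependentColumn : ∀ {J} → LinIndepCols M J → ∀ x → x ∈ J → x ∉ G →
        (∀ z → z ≺c x → z ∈ G → z ∈ J) → ⊥
      noEarlierIndependentColumn {J} indep x x∈J x∉G G-below⊆J = contradiction
        where
        v : Fin m → ℚ
        v = proj₁ (spannedBefore x)
        v-support : ∀ k → v k ≢ 0ℚ → k ∈ G × AtOrBefore k x
        v-support = proj₂ (proj₂ (spannedBefore x))
        v-x : v x ≡ 0ℚ
        v-x with v x ℚP.≟ 0ℚ
        ... | yes vx≡0 = vx≡0
        ... | no vx≢0 = ⊥-elim (x∉G (proj₁ (v-support x vx≢0)))
        d-kernel : InKernel (v ⊖ δ x)
        d-kernel r = trans (comb-⊖ v (δ x) r)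
          (trans (cong₂ (λ a b → a + - b) (proj₁ (proj₂ (spannedBefore x)) r) (comb-δ x r)) (ℚP.+-inverseʳ (M r x)))
        d-support : ∀ k → k ∉ J → (v ⊖ δ x) k ≡ 0ℚ
        d-support k k∉J with k Fin.≟ x | v k ℚP.≟ 0ℚ
        ... | yes refl | _ = ⊥-elim (k∉J x∈J)
        ... | no _ | yes vk≡0 = cong (λ a → a + - 0ℚ) vk≡0
        ... | no k≢x | no vk≢0 with v-support k vk≢0
        ...   | _ , inj₁ k≡x = ⊥-elim (k≢x k≡x)
        ...   | k∈G , inj₂ k≺x = ⊥-elim (k∉J (G-below⊆J k k≺x k∈G))
        contradiction : ⊥
        contradiction with trans (sym (indep (v ⊖ δ x) d-support d-kernel x))
                                 (cong₂ (λ a b → a + - b) v-x (δ-same x))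
        ... | ()

      greedy⇒lexMin : ∀ J → IsBasis M J → ¬ LexLt c (sortedFrom c J) (sortedFrom c G)
      greedy⇒lexMin J (_ , indep) J<G
        with firstDifference (sortedFrom-sorted J) (sortedFrom-sorted G) J<G
      ... | x , x∈J , x∉G , below =
        noEarlierIndependentColumn indep x (∈-sortedFrom⁻ x∈J) (λ x∈G → x∉G (∈-sortedFrom⁺ x∈G))
          (λ z z≺x z∈G → ∈-sortedFrom⁻ (below z z≺x (∈-sortedFrom⁺ z∈G)))

      greedy⇒lexMin-unique : IsBasis M G → ∀ I → IsBasis M I →
        (∀ J → IsBasis M J → ¬ LexLt c (sortedFrom c J) (sortedFrom c I)) → I ≡ G
      greedy⇒lexMin-unique G-basis I I-basis I-min
        with lexIncomparable⇒nested (sortedFrom c I) (sortedFrom c G)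
               (greedy⇒lexMin I I-basis) (I-min G G-basis)
      ... | inj₁ I⊆G = ⊆-sameSize⇒≡ (λ x∈I → ∈-sortedFrom⁻ (I⊆G (∈-sortedFrom⁺ x∈I)))
                         (trans (proj₁ I-basis) (sym (proj₁ G-basis)))
      ... | inj₂ G⊆I = sym (⊆-sameSize⇒≡ (λ x∈G → ∈-sortedFrom⁻ (G⊆I (∈-sortedFrom⁺ x∈G)))
                              (trans (proj₁ G-basis) (sym (proj₁ I-basis))))

module Succession where
  open import Data.Nat using (ℕ)
  open import Data.Fin as Fin using (Fin)
  open import Data.List using (List; []; _∷_; allFin)
  open import Data.List.Membership.Propositional using () renaming (_∈_ to _∈ˡ_)
  open import Data.List.Membership.Propositional.Properties using (∈-allFin)
  open import Data.List.Relation.Unary.Any using (here; there)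
  open import Data.Product using (Σ; _×_; _,_; proj₁; proj₂)
  open import Data.Sum using (_⊎_; inj₁; inj₂)
  open import Relation.Binary.PropositionalEquality
  open import Relation.Nullary using (¬_; yes; no; Dec)
  open import Data.Empty using (⊥; ⊥-elim)

  module LeastIn {A : Set} (_<_ : A → A → Set)
    (trichotomy : ∀ a b → a ≡ b ⊎ a < b ⊎ b < a)
    (<-trans : ∀ {a b c} → a < b → b < c → a < c) where

    leastIn : (P : A → Set) → (∀ a → Dec (P a)) → (xs : List A) →
      (Σ A λ y → P y × (∀ z → z ∈ˡ xs → P z → z ≡ y ⊎ y < z)) ⊎ (∀ z → z ∈ˡ xs → ¬ P z)
    leastIn P P? [] = inj₂ (λ z ())
    leastIn P P? (x ∷ xs) with leastIn P P? xs | P? x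
    ... | inj₂ none | no ¬px = inj₂ (λ { z (here refl) → ¬px ; z (there z∈) → none z z∈ })
    ... | inj₂ none | yes px =
      inj₁ (x , px , λ { z (here refl) _ → inj₁ refl ; z (there z∈) pz → ⊥-elim (none z z∈ pz) })
    ... | inj₁ (y , py , least) | no ¬px =
      inj₁ (y , py , λ { z (here refl) pz → ⊥-elim (¬px pz) ; z (there z∈) pz → least z z∈ pz })
    ... | inj₁ (y , py , least) | yes px with trichotomy x y
    ...   | inj₁ refl = inj₁ (y , py , λ { z (here refl) _ → inj₁ refl ; z (there z∈) pz → least z z∈ pz })
    ...   | inj₂ (inj₂ y<x) = inj₁ (y , py , λ { z (here refl) _ → inj₂ y<x ; z (there z∈) pz → least z z∈ pz })
    ...   | inj₂ (inj₁ x<y) = inj₁ (x , px , λ { z (here refl) _ → inj₁ refl ; z (there z∈) pz → viaY z z∈ pz })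
      where
      viaY : ∀ z → z ∈ˡ xs → P z → z ≡ x ⊎ x < z
      viaY z z∈ pz with least z z∈ pz
      ... | inj₁ refl = inj₂ x<y
      ... | inj₂ y<z = inj₂ (<-trans x<y y<z)

  module CyclicSuccessor {m : ℕ} (_≺_ : Fin m → Fin m → Set)
    (_≺?_ : ∀ a b → Dec (a ≺ b))
    (≺-irrefl : ∀ {a} → ¬ (a ≺ a))
    (≺-trans : ∀ {a b c} → a ≺ b → b ≺ c → a ≺ c)
    (≺-trichotomy : ∀ a b → a ≡ b ⊎ a ≺ b ⊎ b ≺ a)
    (bot top : Fin m) (bot≢top : bot ≢ top)
    (bot-least : ∀ x → x ≢ bot → bot ≺ x)
    (top-greatest : ∀ x → x ≢ top → x ≺ top) where

    ≺-asym : ∀ {a b} → a ≺ b → b ≺ a → ⊥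
    ≺-asym ab ba = ≺-irrefl (≺-trans ab ba)

    top-maximal : ∀ {y} → ¬ (top ≺ y)
    top-maximal {y} top≺y with y Fin.≟ top
    ... | yes refl = ≺-irrefl top≺y
    ... | no y≢top = ≺-asym top≺y (top-greatest y y≢top)

    bot-minimal : ∀ {y} → ¬ (y ≺ bot)
    bot-minimal {y} y≺bot with y Fin.≟ bot
    ... | yes refl = ≺-irrefl y≺bot
    ... | no y≢bot = ≺-asym y≺bot (bot-least y y≢bot)

    flipped-trichotomy : ∀ a b → a ≡ b ⊎ b ≺ a ⊎ a ≺ b
    flipped-trichotomy a b with ≺-trichotomy a b
    ... | inj₁ a≡b = inj₁ a≡b
    ... | inj₂ (inj₁ a≺b) = inj₂ (inj₂ a≺b)
    ... | inj₂ (inj₂ b≺a) = inj₂ (inj₁ b≺a)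

    Covers : Fin m → Fin m → Set
    Covers x y = x ≺ y × (∀ z → ¬ (x ≺ z × z ≺ y))

    Next : Fin m → Fin m → Set
    Next x y = Covers x y ⊎ (x ≡ top × y ≡ bot)

    covers-above : ∀ {x y z} → Covers x y → x ≺ z → z ≡ y ⊎ y ≺ z
    covers-above {x} {y} {z} (x≺y , nothing-between) x≺z with ≺-trichotomy z y
    ... | inj₁ z≡y = inj₁ z≡y
    ... | inj₂ (inj₁ z≺y) = ⊥-elim (nothing-between z (x≺z , z≺y))
    ... | inj₂ (inj₂ y≺z) = inj₂ y≺z

    open LeastIn _≺_ ≺-trichotomy ≺-trans using (leastIn)
    open LeastIn (λ a b → b ≺ a) flipped-trichotomy (λ ab bc → ≺-trans bc ab)
      using () renaming (leastIn to greatestIn)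

    nextOf : ∀ x → Σ (Fin m) (Next x)
    nextOf x with leastIn (x ≺_) (x ≺?_) (allFin m)
    ... | inj₁ (y , x≺y , least) = y , inj₁ (x≺y , nothing-between)
      where
      nothing-between : ∀ z → ¬ (x ≺ z × z ≺ y)
      nothing-between z (x≺z , z≺y) with least z (∈-allFin z) x≺z
      ... | inj₁ refl = ≺-irrefl z≺y
      ... | inj₂ y≺z = ≺-asym y≺z z≺y
    ... | inj₂ none with x Fin.≟ top
    ...   | yes x≡top = bot , inj₂ (x≡top , refl)
    ...   | no x≢top = ⊥-elim (none top (∈-allFin top) (top-greatest x x≢top))

    prevOf : ∀ x → Σ (Fin m) (λ y → Next y x)
    prevOf x with greatestIn (_≺ x) (_≺? x) (allFin m)
    ... | inj₁ (y , y≺x , greatest) = y , inj₁ (y≺x , nothing-between)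
      where
      nothing-between : ∀ z → ¬ (y ≺ z × z ≺ x)
      nothing-between z (y≺z , z≺x) with greatest z (∈-allFin z) z≺x
      ... | inj₁ refl = ≺-irrefl y≺z
      ... | inj₂ z≺y = ≺-asym y≺z z≺y
    ... | inj₂ none with x Fin.≟ bot
    ...   | yes x≡bot = top , inj₂ (refl , x≡bot)
    ...   | no x≢bot = ⊥-elim (none bot (∈-allFin bot) (bot-least x x≢bot))

    next : Fin m → Fin m
    next x = proj₁ (nextOf x)

    next-spec : ∀ x → Next x (next x)
    next-spec x = proj₂ (nextOf x)

    prev : Fin m → Fin m
    prev x = proj₁ (prevOf x)

    prev-spec : ∀ x → Next (prev x) x
    prev-spec x = proj₂ (prevOf x)

    Next-functional : ∀ {x y y'} → Next x y → Next x y' → y ≡ y'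
    Next-functional (inj₁ (x≺y , between)) (inj₁ (x≺y' , between')) with ≺-trichotomy _ _
    ... | inj₁ y≡y' = y≡y'
    ... | inj₂ (inj₁ y≺y') = ⊥-elim (between' _ (x≺y , y≺y'))
    ... | inj₂ (inj₂ y'≺y) = ⊥-elim (between _ (x≺y' , y'≺y))
    Next-functional (inj₁ (x≺y , _)) (inj₂ (refl , _)) = ⊥-elim (top-maximal x≺y)
    Next-functional (inj₂ (refl , _)) (inj₁ (x≺y' , _)) = ⊥-elim (top-maximal x≺y')
    Next-functional (inj₂ (_ , refl)) (inj₂ (_ , refl)) = refl

    Next-injective : ∀ {x x' y} → Next x y → Next x' y → x ≡ x'
    Next-injective (inj₁ (x≺y , between)) (inj₁ (x'≺y , between')) with ≺-trichotomy _ _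
    ... | inj₁ x≡x' = x≡x'
    ... | inj₂ (inj₁ x≺x') = ⊥-elim (between _ (x≺x' , x'≺y))
    ... | inj₂ (inj₂ x'≺x) = ⊥-elim (between' _ (x'≺x , x≺y))
    Next-injective (inj₁ (x≺y , _)) (inj₂ (_ , refl)) = ⊥-elim (bot-minimal x≺y)
    Next-injective (inj₂ (_ , refl)) (inj₁ (x'≺y , _)) = ⊥-elim (bot-minimal x'≺y)
    Next-injective (inj₂ (refl , _)) (inj₂ (refl , _)) = refl

    Next-≢ : ∀ {x y} → Next x y → y ≢ x
    Next-≢ (inj₁ (x≺y , _)) refl = ≺-irrefl x≺y
    Next-≢ (inj₂ (refl , refl)) = bot≢top

    next-prev : ∀ x → next (prev x) ≡ x
    next-prev x = Next-functional (next-spec (prev x)) (prev-spec x)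

    next-injective : ∀ {x x'} → next x ≡ next x' → x ≡ x'
    next-injective {x} {x'} e = Next-injective (next-spec x) (subst (Next x') (sym e) (next-spec x'))

    next≢ : ∀ x → next x ≢ x
    next≢ x = Next-≢ (next-spec x)

    prev≢ : ∀ x → prev x ≢ x
    prev≢ x e = next≢ (prev x) (trans (next-prev x) (sym e))

    next≡⇒prev : ∀ {x c} → next x ≡ c → x ≡ prev c
    next≡⇒prev {x} {c} e = next-injective (trans e (sym (next-prev c)))

    next-covers : ∀ x → x ≢ top → Covers x (next x)
    next-covers x x≢top with next-spec x
    ... | inj₁ covers = covers
    ... | inj₂ (x≡top , _) = ⊥-elim (x≢top x≡top)

    prev-covered : ∀ x → x ≢ bot → Covers (prev x) x
    prev-covered x x≢bot with prev-spec x
    ... | inj₁ covers = covers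
    ... | inj₂ (_ , x≡bot) = ⊥-elim (x≢bot x≡bot)

    next-top : next top ≡ bot
    next-top with next-spec top
    ... | inj₁ (top≺y , _) = ⊥-elim (top-maximal top≺y)
    ... | inj₂ (_ , y≡bot) = y≡bot

    prev-bot : prev bot ≡ top
    prev-bot = sym (Next-injective (inj₂ (refl , refl)) (prev-spec bot))

-- The 2n endpoint labels of an interval representation q_0 < ... < q_{n-1}
-- (n ≥ 1), totally ordered by reading the real line from right to left.
-- Label `R k` (0 ≤ k < n) is the right endpoint q_{n-1-k} + 1, label
-- `L j` is the left endpoint q_j.  Reading right to left, the R-labels
-- increase and the L-labels decrease; R 0 is read first and L 0 last.
module Endpoints (n' : ℕ) (q : Fin (suc n') → ℚ) (inc : StrictlyIncreasing q) where
  open import Defs using (StrictlyIncreasing; endpointValue; RightOf; IsRightEndpoint; IsLeftEndpoint; CycleStep)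
  open Succession
  open import Data.Nat as ℕ using (ℕ; zero; suc)
  import Data.Nat.Properties as ℕP
  open import Data.Fin as Fin using (Fin; toℕ; _↑ˡ_; _↑ʳ_; splitAt; opposite)
  import Data.Fin.Properties as FinP
  open import Data.Rational using (ℚ; 1ℚ; _+_; _<_; _≤_)
  import Data.Rational.Properties as ℚP
  open import Data.Product using (_,_; proj₁)
  open import Data.Sum using (_⊎_; inj₁; inj₂)
  open import Relation.Binary.PropositionalEquality
  open import Relation.Nullary using (¬_; yes; no; Dec)
  open import Relation.Binary.Definitions using (tri<; tri≈; tri>)
  open import Data.Empty using (⊥; ⊥-elim)


  n : ℕ
  n = suc n'

  Lab : Set
  Lab = Fin (n ℕ.+ n)

  R : Fin n → Lab
  R k = k ↑ˡ n

  L : Fin n → Lab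
  L j = n ↑ʳ j

  data EndpointView (x : Lab) : Set where
    right : ∀ k → x ≡ R k → EndpointView x
    left  : ∀ j → x ≡ L j → EndpointView x

  endpointView : ∀ x → EndpointView x
  endpointView x with splitAt n x in eq
  ... | inj₁ k = right k (sym (FinP.splitAt⁻¹-↑ˡ eq))
  ... | inj₂ j = left j (sym (FinP.splitAt⁻¹-↑ʳ eq))

  splitAt-R : ∀ k → splitAt n (R k) ≡ inj₁ k
  splitAt-R k = FinP.splitAt-↑ˡ n k n

  splitAt-L : ∀ j → splitAt n (L j) ≡ inj₂ j
  splitAt-L j = FinP.splitAt-↑ʳ n n j

  toℕ-R : ∀ k → toℕ (R k) ≡ toℕ k
  toℕ-R k = FinP.toℕ-↑ˡ k n

  toℕ-L : ∀ j → toℕ (L j) ≡ n ℕ.+ toℕ j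
  toℕ-L j = FinP.toℕ-↑ʳ n j

  R-label< : ∀ k → toℕ (R k) ℕ.< n
  R-label< k = subst (ℕ._< n) (sym (toℕ-R k)) (FinP.toℕ<n k)

  L-label≥ : ∀ j → n ℕ.≤ toℕ (L j)
  L-label≥ j = subst (n ℕ.≤_) (sym (toℕ-L j)) (ℕP.m≤m+n n (toℕ j))

  R<L-label : ∀ k j → toℕ (R k) ℕ.< toℕ (L j)
  R<L-label k j = ℕP.<-≤-trans (R-label< k) (L-label≥ j)

  L-label< : ∀ {a b} → toℕ a ℕ.< toℕ b → toℕ (L a) ℕ.< toℕ (L b)
  L-label< {a} {b} lt = subst₂ ℕ._<_ (sym (toℕ-L a)) (sym (toℕ-L b)) (ℕP.+-monoʳ-< n lt)

  L-label≤ : ∀ {a b} → toℕ a ℕ.≤ toℕ b → toℕ (L a) ℕ.≤ toℕ (L b)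
  L-label≤ {a} {b} le = subst₂ ℕ._≤_ (sym (toℕ-L a)) (sym (toℕ-L b)) (ℕP.+-monoʳ-≤ n le)

  R-injective : ∀ {a b} → R a ≡ R b → a ≡ b
  R-injective = FinP.↑ˡ-injective n _ _

  L-injective : ∀ {a b} → L a ≡ L b → a ≡ b
  L-injective = FinP.↑ʳ-injective n _ _

  R≢L : ∀ {k j} → R k ≢ L j
  R≢L {k} {j} e = ℕP.<-irrefl (cong toℕ e) (R<L-label k j)

  value-R : ∀ k → endpointValue q (R k) ≡ q (opposite k) + 1ℚ
  value-R k rewrite splitAt-R k = refl

  value-L : ∀ j → endpointValue q (L j) ≡ q j
  value-L j rewrite splitAt-L j = refl

  R-isRight : ∀ k → IsRightEndpoint {n} (R k)
  R-isRight k = k , splitAt-R k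

  L-isLeft : ∀ j → IsLeftEndpoint {n} (L j)
  L-isLeft j = j , splitAt-L j

  notRightAndLeft : ∀ x → IsRightEndpoint {n} x → IsLeftEndpoint {n} x → ⊥
  notRightAndLeft x (k , e₁) (j , e₂) with trans (sym e₁) e₂
  ... | ()

  -- a ≺ b : a lies to the right of b, i.e. a is read before b
  -- (a data type, so that a and b are recoverable from a proof)
  data _≺_ (a b : Lab) : Set where
    rightOf : RightOf q a b → a ≺ b

  ≺-irrefl : ∀ {a} → ¬ (a ≺ a)
  ≺-irrefl (rightOf (inj₁ lt)) = ℚP.<-irrefl refl lt
  ≺-irrefl {a} (rightOf (inj₂ (_ , r , l))) = notRightAndLeft a r l

  ≺-trans : ∀ {a b c} → a ≺ b → b ≺ c → a ≺ c
  ≺-trans (rightOf (inj₁ b<a)) (rightOf (inj₁ c<b)) = rightOf (inj₁ (ℚP.<-trans c<b b<a))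
  ≺-trans (rightOf (inj₁ b<a)) (rightOf (inj₂ (b≡c , _ , _))) = rightOf (inj₁ (subst (_< _) b≡c b<a))
  ≺-trans (rightOf (inj₂ (a≡b , _ , _))) (rightOf (inj₁ c<b)) = rightOf (inj₁ (subst (_ <_) (sym a≡b) c<b))
  ≺-trans {b = b} (rightOf (inj₂ (_ , _ , b-left))) (rightOf (inj₂ (_ , b-right , _))) =
    ⊥-elim (notRightAndLeft b b-right b-left)

  q-mono : ∀ {i j : Fin n} → toℕ i ℕ.< toℕ j → q i < q j
  q-mono {i} {j} lt = inc i j lt

  q-mono-≤ : ∀ {i j : Fin n} → toℕ i ℕ.≤ toℕ j → q i ≤ q j
  q-mono-≤ {i} {j} le with ℕP.m≤n⇒m<n∨m≡n le
  ... | inj₁ lt = ℚP.<⇒≤ (q-mono lt)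
  ... | inj₂ e = ℚP.≤-reflexive (cong q (FinP.toℕ-injective e))

  <+1 : ∀ p → p < p + 1ℚ
  <+1 p = subst (_< p + 1ℚ) (ℚP.+-identityʳ p) (ℚP.+-monoʳ-< p (ℚP.positive⁻¹ 1ℚ))

  opposite-< : ∀ {a b : Fin n} → toℕ a ℕ.< toℕ b → toℕ (opposite b) ℕ.< toℕ (opposite a)
  opposite-< {a} {b} lt rewrite FinP.opposite-prop a | FinP.opposite-prop b =
    ℕP.∸-monoʳ-< (ℕ.s≤s lt) (FinP.toℕ<n b)

  R≺R : ∀ {a b} → toℕ a ℕ.< toℕ b → R a ≺ R b
  R≺R {a} {b} lt =
    rightOf (inj₁ (subst₂ _<_ (sym (value-R b)) (sym (value-R a)) (ℚP.+-monoˡ-< 1ℚ (q-mono (opposite-< lt)))))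

  L≺L : ∀ {a b} → toℕ a ℕ.< toℕ b → L b ≺ L a
  L≺L {a} {b} lt = rightOf (inj₁ (subst₂ _<_ (sym (value-L a)) (sym (value-L b)) (q-mono lt)))

  R≺L⇒ : ∀ k j → R k ≺ L j → ¬ (q (opposite k) + 1ℚ < q j)
  R≺L⇒ k j (rightOf (inj₁ lt)) h = ℚP.<-asym (subst₂ _<_ (value-L j) (value-R k) lt) h
  R≺L⇒ k j (rightOf (inj₂ (e , _ , _))) h = ℚP.<-irrefl (trans (sym (value-R k)) (trans e (value-L j))) h

  R≺L⇐ : ∀ k j → ¬ (q (opposite k) + 1ℚ < q j) → R k ≺ L j
  R≺L⇐ k j h with ℚP.<-cmp (q (opposite k) + 1ℚ) (q j)
  ... | tri< lt _ _ = ⊥-elim (h lt)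
  ... | tri≈ _ e _ = rightOf (inj₂ (trans (value-R k) (trans e (sym (value-L j))) , R-isRight k , L-isLeft j))
  ... | tri> _ _ gt = rightOf (inj₁ (subst₂ _<_ (sym (value-L j)) (sym (value-R k)) gt))

  ≺-trichotomy : ∀ a b → a ≡ b ⊎ a ≺ b ⊎ b ≺ a
  ≺-trichotomy a b with endpointView a | endpointView b
  ... | right k refl | right k' refl with ℕP.<-cmp (toℕ k) (toℕ k')
  ...   | tri< lt _ _ = inj₂ (inj₁ (R≺R lt))
  ...   | tri≈ _ e _ = inj₁ (cong R (FinP.toℕ-injective e))
  ...   | tri> _ _ gt = inj₂ (inj₂ (R≺R gt))
  ≺-trichotomy a b | left j refl | left j' refl with ℕP.<-cmp (toℕ j) (toℕ j')
  ...   | tri< lt _ _ = inj₂ (inj₂ (L≺L lt))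
  ...   | tri≈ _ e _ = inj₁ (cong L (FinP.toℕ-injective e))
  ...   | tri> _ _ gt = inj₂ (inj₁ (L≺L gt))
  ≺-trichotomy a b | right k refl | left j refl with q (opposite k) + 1ℚ ℚP.<? q j
  ...   | yes lt = inj₂ (inj₂ (rightOf (inj₁ (subst₂ _<_ (sym (value-R k)) (sym (value-L j)) lt))))
  ...   | no ¬lt = inj₂ (inj₁ (R≺L⇐ k j ¬lt))
  ≺-trichotomy a b | left j refl | right k refl with q (opposite k) + 1ℚ ℚP.<? q j
  ...   | yes lt = inj₂ (inj₁ (rightOf (inj₁ (subst₂ _<_ (sym (value-R k)) (sym (value-L j)) lt))))
  ...   | no ¬lt = inj₂ (inj₂ (R≺L⇐ k j ¬lt))

  ≺-asym : ∀ {a b} → a ≺ b → b ≺ a → ⊥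
  ≺-asym a≺b b≺a = ≺-irrefl (≺-trans a≺b b≺a)

  _≺?_ : ∀ a b → Dec (a ≺ b)
  a ≺? b with ≺-trichotomy a b
  ... | inj₁ refl = no ≺-irrefl
  ... | inj₂ (inj₁ a≺b) = yes a≺b
  ... | inj₂ (inj₂ b≺a) = no (λ a≺b → ≺-asym a≺b b≺a)

  R≺R⁻ : ∀ {a b} → R a ≺ R b → toℕ a ℕ.< toℕ b
  R≺R⁻ {a} {b} h with ℕP.<-cmp (toℕ a) (toℕ b)
  ... | tri< lt _ _ = lt
  ... | tri≈ _ e _ rewrite FinP.toℕ-injective e = ⊥-elim (≺-irrefl h)
  ... | tri> _ _ gt = ⊥-elim (≺-asym h (R≺R gt))

  L≺L⁻ : ∀ {a b} → L a ≺ L b → toℕ b ℕ.< toℕ a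
  L≺L⁻ {a} {b} h with ℕP.<-cmp (toℕ a) (toℕ b)
  ... | tri> _ _ gt = gt
  ... | tri≈ _ e _ rewrite FinP.toℕ-injective e = ⊥-elim (≺-irrefl h)
  ... | tri< lt _ _ = ⊥-elim (≺-asym h (L≺L lt))

  R0-first : ∀ x → x ≢ R Fin.zero → R Fin.zero ≺ x
  R0-first x x≢R0 with endpointView x
  ... | right Fin.zero refl = ⊥-elim (x≢R0 refl)
  ... | right (Fin.suc k) refl = R≺R {Fin.zero} {Fin.suc k} (ℕ.s≤s ℕ.z≤n)
  ... | left j refl = rightOf (inj₁ (subst₂ _<_ (sym (value-L j)) (sym (value-R Fin.zero))
                             (ℚP.≤-<-trans (q-mono-≤ {j} {opposite Fin.zero} j≤last) (<+1 _))))
    where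
    j≤last : toℕ j ℕ.≤ toℕ (opposite {n} Fin.zero)
    j≤last = subst (toℕ j ℕ.≤_) (sym (FinP.opposite-prop {n} Fin.zero)) (ℕP.≤-pred (FinP.toℕ<n j))

  L0-last : ∀ x → x ≢ L Fin.zero → x ≺ L Fin.zero
  L0-last x x≢L0 with endpointView x
  ... | right k refl = rightOf (inj₁ (subst₂ _<_ (sym (value-L Fin.zero)) (sym (value-R k))
                              (ℚP.≤-<-trans (q-mono-≤ {Fin.zero} {opposite k} ℕ.z≤n) (<+1 _))))
  ... | left Fin.zero refl = ⊥-elim (x≢L0 refl)
  ... | left (Fin.suc j) refl = L≺L {Fin.zero} {Fin.suc j} (ℕ.s≤s ℕ.z≤n)

  -- σ x : the label read right after x (the label after L 0 being R 0)
  open CyclicSuccessor _≺_ _≺?_ ≺-irrefl ≺-trans ≺-trichotomy (R Fin.zero) (L Fin.zero) R≢L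
         R0-first L0-last public hiding (≺-asym)
    renaming (next to σ; next-spec to σ-spec; next≢ to σ≢; next-prev to σ-prev;
              next≡⇒prev to σ≡⇒prev; next-covers to σ-covers; next-top to σ-L0)

  -- the label read after R k is R (k+1) or an L-label: its label is larger
  σ-R-label : ∀ k → toℕ (R k) ℕ.< toℕ (σ (R k))
  σ-R-label k with endpointView (σ (R k))
  ... | right t e = subst (λ u → toℕ (R k) ℕ.< toℕ u) (sym e)
                      (subst₂ ℕ._<_ (sym (toℕ-R k)) (sym (toℕ-R t))
                        (R≺R⁻ (subst (R k ≺_) e (proj₁ (σ-covers (R k) R≢L)))))
  ... | left t e = subst (λ u → toℕ (R k) ℕ.< toℕ u) (sym e) (R<L-label k t)

  σ-R-R : ∀ k t → σ (R k) ≡ R t → toℕ t ≡ suc (toℕ k)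
  σ-R-R k t e with σ-covers (R k) R≢L
  ... | k≺σ , nothing-between with ℕP.m≤n⇒m<n∨m≡n (R≺R⁻ (subst (R k ≺_) e k≺σ))
  ...   | inj₂ t≡1+k = sym t≡1+k
  ...   | inj₁ 1+k<t = ⊥-elim (nothing-between (R k₁)
            (R≺R {k} {k₁} k<k₁ , subst (R k₁ ≺_) (sym e) (R≺R {k₁} {t} k₁<t)))
    where
    k₁ : Fin n
    k₁ = Fin.fromℕ< (ℕP.<-trans 1+k<t (FinP.toℕ<n t))
    k₁≡1+k : toℕ k₁ ≡ suc (toℕ k)
    k₁≡1+k = FinP.toℕ-fromℕ< (ℕP.<-trans 1+k<t (FinP.toℕ<n t))
    k<k₁ : toℕ k ℕ.< toℕ k₁
    k<k₁ = subst (toℕ k ℕ.<_) (sym k₁≡1+k) (ℕP.n<1+n _)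
    k₁<t : toℕ k₁ ℕ.< toℕ t
    k₁<t = subst (ℕ._< toℕ t) (sym k₁≡1+k) 1+k<t

  -- the label read after L j is R 0 (for j = 0), an R-label or L (j-1):
  -- its label is smaller
  σ-L-label : ∀ j → toℕ (σ (L j)) ℕ.< toℕ (L j)
  σ-L-label Fin.zero rewrite σ-L0 = R<L-label Fin.zero Fin.zero
  σ-L-label (Fin.suc j) with endpointView (σ (L (Fin.suc j)))
  ... | right t e = subst (λ u → toℕ u ℕ.< toℕ (L (Fin.suc j))) (sym e) (R<L-label t (Fin.suc j))
  ... | left t e = subst (λ u → toℕ u ℕ.< toℕ (L (Fin.suc j))) (sym e)
                     (L-label< (L≺L⁻ (subst (L (Fin.suc j) ≺_) e
                        (proj₁ (σ-covers (L (Fin.suc j)) (λ e' → case (L-injective e')))))))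
    where
    case : Fin.suc j ≢ Fin.zero
    case ()

  next⇒cycleStep : ∀ {x y} → Next x y → CycleStep q x y
  next⇒cycleStep (inj₁ (rightOf x-right , nothing-between)) =
    inj₁ (x-right , λ z (x-right-z , z-right) → nothing-between z (rightOf x-right-z , rightOf z-right))
  next⇒cycleStep (inj₂ (refl , refl)) =
    inj₂ ((λ z z≢ → unwrap (L0-last z z≢)) , (λ z z≢ → unwrap (R0-first z z≢)))
    where
    unwrap : ∀ {a b} → a ≺ b → RightOf q a b
    unwrap (rightOf h) = h

-- Moving the start from c to c+1 exchanges c for the label read just
-- before c, exactly as the cycle σ prescribes.
module CandidateBasis (n' : ℕ) (q : Fin (suc n') → ℚ) (inc : StrictlyIncreasing q) where
  open import Defs using (StrictlyIncreasing; nextMod)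
  open CyclicOrder
  open Subsets
  open import Data.Nat as ℕ using (ℕ; suc)
  import Data.Nat.Properties as ℕP
  open import Data.Fin as Fin using (Fin; toℕ)
  import Data.Fin.Properties as FinP
  open import Data.Fin.Subset using (Subset; _∈_; _∉_; ∣_∣; _-_; _∪_; ⁅_⁆; _⊆_)
  open import Data.Fin.Subset.Properties using (⊆-antisym; x∈p∪q⁻; x∈p∪q⁺; x∈⁅y⁆⇒x≡y; x∈⁅x⁆; x∈p∧x≢y⇒x∈p-y)
  open import Data.Rational using (ℚ)
  open import Data.Product using (_,_)
  open import Data.Sum using (_⊎_; inj₁; inj₂)
  open import Relation.Binary.PropositionalEquality
  open import Relation.Nullary using (yes; no)
  open import Data.Empty using (⊥-elim)

  open Endpoints n' q inc public

  InG : Lab → Lab → Set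
  InG c x = CycLt (toℕ c) (toℕ x) (toℕ (σ x))

  G : Lab → Subset (n ℕ.+ n)
  G c = fromDec (λ x → cycLt? (toℕ c) (toℕ x) (toℕ (σ x)))

  G⁺ : ∀ {c x} → InG c x → x ∈ G c
  G⁺ {c} = ∈-fromDec⁺ (λ x → cycLt? (toℕ c) (toℕ x) (toℕ (σ x)))

  G⁻ : ∀ {c x} → x ∈ G c → InG c x
  G⁻ {c} = ∈-fromDec⁻ (λ x → cycLt? (toℕ c) (toℕ x) (toℕ (σ x)))

  ∉G : ∀ {c x} → x ∉ G c → CycLt (toℕ c) (toℕ (σ x)) (toℕ x)
  ∉G {c} {x} x∉ with cycLt-connex (toℕ c) (toℕ x) (toℕ (σ x)) (λ e → σ≢ x (sym (FinP.toℕ-injective e)))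
  ... | inj₁ h = ⊥-elim (x∉ (G⁺ h))
  ... | inj₂ h = h

  ∉G-ascent : ∀ {c x} → toℕ x ℕ.< toℕ (σ x) → toℕ x ℕ.< toℕ c → toℕ c ℕ.≤ toℕ (σ x) → x ∉ G c
  ∉G-ascent x<σx x<c c≤σx x∈ with G⁻ x∈
  ... | inj₁ (c≤x , _) = ℕP.<⇒≱ x<c c≤x
  ... | inj₂ (inj₁ (_ , σx<c)) = ℕP.<⇒≱ σx<c c≤σx
  ... | inj₂ (inj₂ (σx<c , _)) = ℕP.<⇒≱ σx<c c≤σx

  ∉G-descent : ∀ {c x} → toℕ (σ x) ℕ.< toℕ x → (toℕ c ℕ.≤ toℕ (σ x)) ⊎ (toℕ x ℕ.< toℕ c) → x ∉ G c
  ∉G-descent σx<x c-outside x∈ with cycLt-descent σx<x (G⁻ x∈) | c-outside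
  ... | σx<c , _ | inj₁ c≤σx = ℕP.<⇒≱ σx<c c≤σx
  ... | _ , c≤x | inj₂ x<c = ℕP.<⇒≱ x<c c≤x

  toℕ≢ : ∀ {a b : Lab} → a ≢ b → toℕ a ≢ toℕ b
  toℕ≢ a≢b e = a≢b (FinP.toℕ-injective e)

  module Exchange (c : Lab) where
    j : Lab
    j = prev c

    c' : Lab
    c' = nextMod c

    c-next : IsNextMod (n ℕ.+ n) (toℕ c) (toℕ c')
    c-next = nextMod-isNextMod c

    c∈G : c ∈ G c
    c∈G = G⁺ (cycLt-first (toℕ≢ (σ≢ c)))

    c∉G' : c ∉ G c'
    c∉G' c∈ = cycLt-asym (G⁻ c∈) (cycLt-last c-next (FinP.toℕ<n (σ c)) (toℕ≢ (σ≢ c)))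

    j∉G : j ∉ G c
    j∉G j∈ = cycLt-asym (subst (λ u → CycLt (toℕ c) (toℕ j) (toℕ u)) (σ-prev c) (G⁻ j∈))
                        (cycLt-first (toℕ≢ (prev≢ c)))

    j∈G' : j ∈ G c'
    j∈G' = G⁺ (subst (λ u → CycLt (toℕ c') (toℕ j) (toℕ u)) (sym (σ-prev c))
                 (cycLt-last c-next (FinP.toℕ<n j) (toℕ≢ (prev≢ c))))

    -- x and σ x keep their relative order from c to c+1 when x ≠ c ...
    stable⁺ : ∀ {x} → x ≢ c → x ∈ G c → x ∈ G c'
    stable⁺ {x} x≢c x∈ =
      G⁺ (cycLt-advance c-next (FinP.toℕ<n x) (toℕ≢ x≢c) (G⁻ x∈))

    -- ... and back from c+1 to c when σ x ≠ c, i.e. x ≠ j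
    stable⁻ : ∀ {x} → x ≢ j → x ∈ G c' → x ∈ G c
    stable⁻ {x} x≢j x∈ =
      G⁺ (cycLt-retreat c-next (FinP.toℕ<n (σ x)) (toℕ≢ (λ e → x≢j (σ≡⇒prev e))) (G⁻ x∈))

    G-exchange : G c' ≡ (G c - c) ∪ ⁅ j ⁆
    G-exchange = ⊆-antisym to from
      where
      to : G c' ⊆ (G c - c) ∪ ⁅ j ⁆
      to {x} x∈ with x Fin.≟ j
      ... | yes refl = x∈p∪q⁺ (inj₂ (x∈⁅x⁆ j))
      ... | no x≢j with x Fin.≟ c
      ...   | yes refl = ⊥-elim (c∉G' x∈)
      ...   | no x≢c = x∈p∪q⁺ (inj₁ (x∈p∧x≢y⇒x∈p-y (stable⁻ x≢j x∈) x≢c))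
      from : (G c - c) ∪ ⁅ j ⁆ ⊆ G c'
      from {x} x∈ with x∈p∪q⁻ (G c - c) ⁅ j ⁆ x∈
      ... | inj₂ x∈⁅j⁆ = subst (_∈ G c') (sym (x∈⁅y⁆⇒x≡y j x∈⁅j⁆)) j∈G'
      ... | inj₁ x∈G-c = stable⁺ (x∈p-y⇒x≢y x∈G-c) (x∈p-y⇒x∈p x∈G-c)

    ∣G'∣≡∣G∣ : ∣ G c' ∣ ≡ ∣ G c ∣
    ∣G'∣≡∣G∣ = trans (cong ∣_∣ G-exchange) (∣exchange∣ (G c) c∈G j∉G)

  R0-label : toℕ (R Fin.zero) ≡ 0
  R0-label = toℕ-R Fin.zero

  R∈G0 : ∀ k → R k ∈ G (R Fin.zero)
  R∈G0 k = G⁺ (subst (λ u → CycLt u (toℕ (R k)) (toℕ (σ (R k)))) (sym R0-label)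
                 (inj₁ (ℕ.z≤n , σ-R-label k)))

  L∉G0 : ∀ j → L j ∉ G (R Fin.zero)
  L∉G0 j L∈ with subst (λ u → CycLt u (toℕ (L j)) (toℕ (σ (L j)))) R0-label (G⁻ L∈)
  ... | inj₁ (_ , lt) = ℕP.<-asym lt (σ-L-label j)
  ... | inj₂ (inj₁ (_ , ()))
  ... | inj₂ (inj₂ (() , _))

  ∣G0∣ : ∣ G (R Fin.zero) ∣ ≡ n
  ∣G0∣ = ∣firstBlock∣ n (G (R Fin.zero)) R∈G0 L∉G0

  ∣G∣ : ∀ c → ∣ G c ∣ ≡ n
  ∣G∣ = nextMod-induction (λ c → ∣ G c ∣ ≡ n) ∣G0∣ (λ c ∣Gc∣ → trans (Exchange.∣G'∣≡∣G∣ c) ∣Gc∣)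

-- The matrix ψ(A) of the antiadjacency matrix A, with columns indexed by
-- endpoint labels: column R k is the unit vector e_k, and column L j has
-- entry ±1 in row r exactly when R r is read before L j, i.e. when the
-- interval of n-1-r does not end before q_j.
module Matrix (n' : ℕ) (q : Fin (suc n') → ℚ) (inc : StrictlyIncreasing q) where
  open import Defs using (StrictlyIncreasing; psi; antiadj; sign; sumF)
  open FiniteSums
  open Columns
  open import Data.Nat using (ℕ; suc; _∸_)
  open import Data.Fin as Fin using (Fin; toℕ; splitAt; opposite)
  open import Data.Rational using (ℚ; 0ℚ; 1ℚ; _+_; _*_; -_; _<_)
  import Data.Rational.Properties as ℚP
  open import Data.Bool using (if_then_else_)
  open import Data.Product using (_×_; _,_)
  open import Data.Sum using (_⊎_; inj₁; inj₂)
  open import Relation.Binary.PropositionalEquality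
  open import Relation.Nullary using (¬_; yes; no; Dec; does)
  open import Data.Empty using (⊥-elim)
  open import Data.Rational.Solver using (module +-*-Solver)
  open +-*-Solver using (solve; _:*_; _:+_; :-_; con; _:=_)

  open Endpoints n' q inc

  M : Fin n → Lab → ℚ
  M = psi (antiadj q)

  open Combination M public

  sgn : Fin n → ℚ
  sgn r = sign (n ∸ suc (toℕ r))

  sgn² : ∀ r → sgn r * sgn r ≡ 1ℚ
  sgn² r = sign² (n ∸ suc (toℕ r))

  M-R : ∀ r k → M r (R k) ≡ δ k r
  M-R r k rewrite splitAt-R k = refl

  M-L : ∀ r j → M r (L j) ≡ sgn r * antiadj q (opposite r) j
  M-L r j rewrite splitAt-L j = refl

  antiadj-≺ : ∀ k y → R k ≺ L y → antiadj q (opposite k) y ≡ 1ℚ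
  antiadj-≺ k y h = entry (q (opposite k) + 1ℚ ℚP.<? q y)
    where
    entry : (d : Dec (q (opposite k) + 1ℚ < q y)) → (if does d then 0ℚ else 1ℚ) ≡ 1ℚ
    entry (yes lt) = ⊥-elim (R≺L⇒ k y h lt)
    entry (no _) = refl

  antiadj-⊀ : ∀ k y → ¬ (R k ≺ L y) → antiadj q (opposite k) y ≡ 0ℚ
  antiadj-⊀ k y h = entry (q (opposite k) + 1ℚ ℚP.<? q y)
    where
    entry : (d : Dec (q (opposite k) + 1ℚ < q y)) → (if does d then 0ℚ else 1ℚ) ≡ 0ℚ
    entry (yes _) = refl
    entry (no ¬lt) = ⊥-elim (h (R≺L⇐ k y ¬lt))

  M-L-≺ : ∀ r y → R r ≺ L y → M r (L y) ≡ sgn r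
  M-L-≺ r y h = trans (M-L r y) (trans (cong (sgn r *_) (antiadj-≺ r y h)) (ℚP.*-identityʳ (sgn r)))

  M-L-⊀ : ∀ r y → ¬ (R r ≺ L y) → M r (L y) ≡ 0ℚ
  M-L-⊀ r y h = trans (M-L r y) (trans (cong (sgn r *_) (antiadj-⊀ r y h)) (ℚP.*-zeroʳ (sgn r)))

  comb-split : ∀ v r → comb v r ≡ sumF (λ k → v (R k) * M r (R k)) + sumF (λ t → v (L t) * M r (L t))
  comb-split v r = sumF-split n n (λ x → v x * M r x)

  -- B y : column L y minus its expansion in the unit columns R k
  B : Fin n → Lab → ℚ
  B y x with splitAt n x
  ... | inj₁ k = - M k (L y)
  ... | inj₂ t = δ y t

  B-R : ∀ y k → B y (R k) ≡ - M k (L y)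
  B-R y k rewrite splitAt-R k = refl

  B-L : ∀ y t → B y (L t) ≡ δ y t
  B-L y t rewrite splitAt-L t = refl

  B-kernel : ∀ y → InKernel (B y)
  B-kernel y r = begin
    comb (B y) r
      ≡⟨ comb-split (B y) r ⟩
    sumF (λ k → B y (R k) * M r (R k)) + sumF (λ t → B y (L t) * M r (L t))
      ≡⟨ cong₂ _+_ (sumF-single (λ k → B y (R k) * M r (R k)) r
                     (λ k k≢r → trans (cong (B y (R k) *_) (trans (M-R r k) (δ-diff (λ e → k≢r (sym e)))))
                                      (ℚP.*-zeroʳ (B y (R k)))))
                   (sumF-single (λ t → B y (L t) * M r (L t)) y
                     (λ t t≢y → trans (cong (_* M r (L t)) (trans (B-L y t) (δ-diff t≢y)))
                                      (ℚP.*-zeroˡ (M r (L t))))) ⟩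
    B y (R r) * M r (R r) + B y (L y) * M r (L y)
      ≡⟨ cong₂ _+_ (cong₂ _*_ (B-R y r) (trans (M-R r r) (δ-same r)))
                   (cong (_* M r (L y)) (trans (B-L y y) (δ-same y))) ⟩
    - M r (L y) * 1ℚ + 1ℚ * M r (L y)
      ≡⟨ solve 1 (λ X → (:- X) :* con 1ℚ :+ con 1ℚ :* X := con 0ℚ) refl (M r (L y)) ⟩
    0ℚ ∎
    where open ≡-Reasoning

  B-support-L : ∀ y t → B y (L t) ≢ 0ℚ → t ≡ y
  B-support-L y t nz with t Fin.≟ y
  ... | yes t≡y = t≡y
  ... | no t≢y = ⊥-elim (nz (trans (B-L y t) (δ-diff t≢y)))

  B-R-≺ : ∀ y k → R k ≺ L y → B y (R k) ≡ - sgn k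
  B-R-≺ y k h = trans (B-R y k) (cong -_ (M-L-≺ k y h))

  B-R-⊀ : ∀ y k → ¬ (R k ≺ L y) → B y (R k) ≡ 0ℚ
  B-R-⊀ y k h = trans (B-R y k) (cong -_ (M-L-⊀ k y h))

  B-support-R : ∀ y k → B y (R k) ≢ 0ℚ → R k ≺ L y
  B-support-R y k nz with R k ≺? L y
  ... | yes h = h
  ... | no h = ⊥-elim (nz (B-R-⊀ y k h))

  D : Fin n → Fin n → Lab → ℚ
  D y y' = B y ⊖ B y'

  D-kernel : ∀ y y' → InKernel (D y y')
  D-kernel y y' = ⊖-inKernel {B y} {B y'} (B-kernel y) (B-kernel y')

  D-support-L : ∀ y y' t → D y y' (L t) ≢ 0ℚ → t ≡ y ⊎ t ≡ y'
  D-support-L y y' t nz with t Fin.≟ y | t Fin.≟ y'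
  ... | yes t≡y | _ = inj₁ t≡y
  ... | no _ | yes t≡y' = inj₂ t≡y'
  ... | no t≢y | no t≢y' = ⊥-elim (nz (trans (cong₂ (λ a b → a + - b) (trans (B-L y t) (δ-diff t≢y))
                                                                       (trans (B-L y' t) (δ-diff t≢y')))
                                              (ℚP.+-inverseʳ 0ℚ)))

  D-support-R : ∀ y y' k → D y y' (R k) ≢ 0ℚ →
                (R k ≺ L y × ¬ (R k ≺ L y')) ⊎ (¬ (R k ≺ L y) × R k ≺ L y')
  D-support-R y y' k nz with R k ≺? L y | R k ≺? L y'
  ... | yes a | no b = inj₁ (a , b)
  ... | no a | yes b = inj₂ (a , b)
  ... | yes a | yes b = ⊥-elim (nz (trans (cong₂ (λ u v → u + - v) (B-R-≺ y k a) (B-R-≺ y' k b))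
                                         (ℚP.+-inverseʳ (- sgn k))))
  ... | no a | no b = ⊥-elim (nz (trans (cong₂ (λ u v → u + - v) (B-R-⊀ y k a) (B-R-⊀ y' k b))
                                         (ℚP.+-inverseʳ 0ℚ)))

-- For every start label c, each label x outside G c gets an explicit
-- kernel vector of ψ(A) with entry 1 at x supported on x and labels
-- before x: G c is greedy in the sense of `GreedyBasis`.  The vectors are
-- the B y / B y - B y' of `Matrix`, chosen according to the kind of x and
-- of the label σ x read after it.
module Witnesses (n' : ℕ) (q : Fin (suc n') → ℚ) (inc : StrictlyIncreasing q) where
  open import Defs using (StrictlyIncreasing)
  open CyclicOrder
  open CyclicSorting
  open Columns
  open LexMin
  open import Data.Nat as ℕ using (ℕ; zero; suc)
  import Data.Nat.Properties as ℕP
  open import Data.Fin as Fin using (Fin; toℕ)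
  import Data.Fin.Properties as FinP
  open import Data.Fin.Subset using (_∉_)
  open import Data.Rational using (ℚ; 0ℚ; 1ℚ; _+_; -_)
  import Data.Rational.Properties as ℚP
  open import Data.Product using (_×_; _,_; proj₁; proj₂)
  open import Data.Sum using (_⊎_; inj₁; inj₂)
  open import Relation.Binary.PropositionalEquality
  open import Relation.Nullary using (yes; no)
  open import Data.Empty using (⊥; ⊥-elim)

  open CandidateBasis n' q inc public
  open Matrix n' q inc public

  module DependenciesFrom (c : Lab) where
    open SortedFrom c using (_≺c_; cycLt⇒≺c)
    open GreedyBasis M c using (EarlierDependency; Greedy)

    beforeExcluded : ∀ {x z} → x ∉ G c → toℕ (σ x) ℕ.≤ toℕ z → toℕ z ℕ.< toℕ x → z ≺c x
    beforeExcluded x∉ σx≤z z<x = cycLt⇒≺c (cycLt-between (∉G x∉) σx≤z z<x)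

    dependency-L0 : L Fin.zero ∉ G c → EarlierDependency (L Fin.zero)
    dependency-L0 x∉ = B Fin.zero , B-kernel Fin.zero , trans (B-L Fin.zero Fin.zero) (δ-same {n} Fin.zero) , support
      where
      σL0-label : toℕ (σ (L Fin.zero)) ≡ 0
      σL0-label = trans (cong toℕ σ-L0) R0-label
      support : ∀ k → B Fin.zero k ≢ 0ℚ → k ≡ L Fin.zero ⊎ k ≺c L Fin.zero
      support k nz with endpointView k
      ... | right k' refl = inj₂ (beforeExcluded x∉ (subst (ℕ._≤ toℕ (R k')) (sym σL0-label) ℕ.z≤n)
                                                   (R<L-label k' Fin.zero))
      ... | left t refl = inj₁ (cong L (B-support-L Fin.zero t nz))

    -- For x = L (t+1): use B (t+1) - B t.  The labels read after x up to
    -- L t are numbered at least σ x, since no L-label lies in between.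
    dependency-Lsuc : ∀ t → L (Fin.suc t) ∉ G c → EarlierDependency (L (Fin.suc t))
    dependency-Lsuc t x∉ = D j j' , D-kernel j j' , value , support
      where
      j j' : Fin n
      j = Fin.suc t
      j' = Fin.inject₁ t
      x = L j
      j'<j : toℕ j' ℕ.< toℕ j
      j'<j = subst (ℕ._< suc (toℕ t)) (sym (FinP.toℕ-inject₁ t)) (ℕP.n<1+n (toℕ t))
      x≺L' : x ≺ L j'
      x≺L' = L≺L j'<j
      x-covered : Covers x (σ x)
      x-covered = σ-covers x (λ e → case (L-injective e))
        where
        case : Fin.suc t ≢ Fin.zero
        case ()
      noLBetween : ∀ u → x ≺ L u → L u ≺ L j' → ⊥
      noLBetween u x≺u u≺j' = ℕP.<-irrefl refl
        (ℕP.<-≤-trans (subst (ℕ._< toℕ u) (FinP.toℕ-inject₁ t) (L≺L⁻ u≺j')) (ℕP.≤-pred (L≺L⁻ x≺u)))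
      σx≤ : ∀ z → x ≺ z → z ≺ L j' ⊎ z ≡ L j' → toℕ (σ x) ℕ.≤ toℕ z
      σx≤ z x≺z z≼j' with covers-above x-covered x≺z
      ... | inj₁ refl = ℕP.≤-refl
      ... | inj₂ σx≺z with endpointView (σ x)
      ...   | left u e = ⊥-elim (noLBetween u (subst (x ≺_) e (proj₁ x-covered)) (u≺j' z≼j'))
        where
        u≺j' : z ≺ L j' ⊎ z ≡ L j' → L u ≺ L j'
        u≺j' (inj₁ z≺j') = ≺-trans (subst (_≺ z) e σx≺z) z≺j'
        u≺j' (inj₂ refl) = subst (_≺ z) e σx≺z
      ...   | right u e rewrite e with endpointView z
      ...     | right k refl = subst₂ ℕ._≤_ (sym (toℕ-R u)) (sym (toℕ-R k)) (ℕP.<⇒≤ (R≺R⁻ σx≺z))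
      ...     | left v refl = ℕP.<⇒≤ (R<L-label u v)
      value : D j j' x ≡ 1ℚ
      value = trans (cong₂ (λ a b → a + - b) (trans (B-L j j) (δ-same {n} j))
                                             (trans (B-L j' j) (δ-diff {n} (λ e → ℕP.<-irrefl (cong toℕ (sym e)) j'<j))))
                    (ℚP.+-identityʳ 1ℚ)
      support : ∀ k → D j j' k ≢ 0ℚ → k ≡ x ⊎ k ≺c x
      support k nz with endpointView k
      ... | left u refl with D-support-L j j' u nz
      ...   | inj₁ refl = inj₁ refl
      ...   | inj₂ refl = inj₂ (beforeExcluded x∉ (σx≤ (L j') x≺L' (inj₂ refl)) (L-label< j'<j))
      support k nz | right k' refl with D-support-R j j' k' nz
      ... | inj₁ (k≺x , k⊀L') = ⊥-elim (k⊀L' (≺-trans k≺x x≺L'))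
      ... | inj₂ (k⊀x , k≺L') with ≺-trichotomy (R k') x
      ...   | inj₁ e = ⊥-elim (R≢L e)
      ...   | inj₂ (inj₁ k≺x) = ⊥-elim (k⊀x k≺x)
      ...   | inj₂ (inj₂ x≺k) = inj₂ (beforeExcluded x∉ (σx≤ (R k') x≺k (inj₁ k≺L')) (R<L-label k' j))

    -- For x = R r with σ x = R (r+1): the order from c starts at r+1, so
    -- every other label precedes R r; use B 0, rescaled.
    dependency-R-R : ∀ r t → σ (R r) ≡ R t → R r ∉ G c → EarlierDependency (R r)
    dependency-R-R r t e x∉ =
      (- sgn r) ⊙ B Fin.zero , ⊙-inKernel (- sgn r) {B Fin.zero} (B-kernel Fin.zero) ,
      ⊙-normalise (sgn r) (B Fin.zero) (R r) (sgn² r) (B-R-≺ Fin.zero r (L0-last (R r) R≢L)) , support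
      where
      σx-label : toℕ (σ (R r)) ≡ suc (toℕ (R r))
      σx-label = trans (cong toℕ e) (trans (toℕ-R t) (trans (σ-R-R r t e) (cong suc (sym (toℕ-R r)))))
      wraps : CycLt (toℕ c) (suc (toℕ (R r))) (toℕ (R r))
      wraps = subst (λ u → CycLt (toℕ c) u (toℕ (R r))) σx-label (∉G x∉)
      support : ∀ k → ((- sgn r) ⊙ B Fin.zero) k ≢ 0ℚ → k ≡ R r ⊎ k ≺c R r
      support k _ with k Fin.≟ R r
      ... | yes k≡x = inj₁ k≡x
      ... | no k≢x = inj₂ (cycLt⇒≺c (cycLt-wrapSuc {ℕ.suc n' ℕ.+ ℕ.suc n'} wraps (FinP.toℕ<n k) (toℕ≢ k≢x)))

    -- For x = R r with σ x = L t, outside G c: the cyclic order from c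
    -- starts after label R r and at or before label L t, so the L-labels
    -- from L t on and the R-labels below r precede R r.
    module ExcludedRBeforeL (r t : Fin n) (e : σ (R r) ≡ L t) (x∉ : R r ∉ G c) where

      R≺L : R r ≺ L t
      R≺L = subst (R r ≺_) e (proj₁ (σ-covers (R r) R≢L))

      nothingBetween : ∀ {z} → R r ≺ z → z ≺ L t → ⊥
      nothingBetween r≺z z≺t = proj₂ (σ-covers (R r) R≢L) _ (r≺z , subst (_ ≺_) (sym e) z≺t)

      start : toℕ (R r) ℕ.< toℕ c × toℕ c ℕ.≤ toℕ (L t)
      start = cycLt-descent (R<L-label r t) (subst (λ u → CycLt (toℕ c) (toℕ u) (toℕ (R r))) e (∉G x∉))

      L-before : ∀ u → toℕ t ℕ.≤ toℕ u → L u ≺c R r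
      L-before u t≤u = cycLt⇒≺c (inj₂ (inj₂ (proj₁ start , ℕP.≤-trans (proj₂ start) (L-label≤ t≤u))))

      R-before : ∀ k → R k ≺ L t → k ≢ r → R k ≺c R r
      R-before k k≺t k≢r with ≺-trichotomy (R k) (R r)
      ... | inj₁ eq = ⊥-elim (k≢r (R-injective eq))
      ... | inj₂ (inj₂ r≺k) = ⊥-elim (nothingBetween r≺k k≺t)
      ... | inj₂ (inj₁ k≺r) =
        cycLt⇒≺c (inj₂ (inj₁ (subst₂ ℕ._<_ (sym (toℕ-R k)) (sym (toℕ-R r)) (R≺R⁻ k≺r) , proj₁ start)))

    -- Use B t - B (t+1), or B t when t is the last index.
    dependency-R-L : ∀ r t → σ (R r) ≡ L t → R r ∉ G c → EarlierDependency (R r)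
    dependency-R-L r t e x∉ with suc (toℕ t) ℕP.<? n
    ... | yes 1+t<n = (- sgn r) ⊙ D t t₁ , ⊙-inKernel (- sgn r) {D t t₁} (D-kernel t t₁) ,
                      ⊙-normalise (sgn r) (D t t₁) (R r) (sgn² r) value , support
      where
      open ExcludedRBeforeL r t e x∉
      t₁ : Fin n
      t₁ = Fin.fromℕ< 1+t<n
      t₁≡1+t : toℕ t₁ ≡ suc (toℕ t)
      t₁≡1+t = FinP.toℕ-fromℕ< 1+t<n
      t₁≺t : L t₁ ≺ L t
      t₁≺t = L≺L (subst (toℕ t ℕ.<_) (sym t₁≡1+t) (ℕP.n<1+n _))
      value : D t t₁ (R r) ≡ - sgn r
      value = trans (cong₂ (λ a b → a + - b) (B-R-≺ t r R≺L) (B-R-⊀ t₁ r (λ r≺t₁ → nothingBetween r≺t₁ t₁≺t)))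
                    (ℚP.+-identityʳ (- sgn r))
      support : ∀ k → ((- sgn r) ⊙ D t t₁) k ≢ 0ℚ → k ≡ R r ⊎ k ≺c R r
      support k nz with endpointView k
      ... | left u refl with D-support-L t t₁ u (⊙-support (- sgn r) (D t t₁) (L u) nz)
      ...   | inj₁ refl = inj₂ (L-before t ℕP.≤-refl)
      ...   | inj₂ refl = inj₂ (L-before t₁ (subst (toℕ t ℕ.≤_) (sym t₁≡1+t) (ℕP.n≤1+n _)))
      support k nz | right k' refl with k' Fin.≟ r
      ... | yes refl = inj₁ refl
      ... | no k'≢r with D-support-R t t₁ k' (⊙-support (- sgn r) (D t t₁) (R k') nz)
      ...   | inj₁ (k≺t , _) = inj₂ (R-before k' k≺t k'≢r)
      ...   | inj₂ (_ , k≺t₁) = inj₂ (R-before k' (≺-trans k≺t₁ t₁≺t) k'≢r)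
    ... | no _ = (- sgn r) ⊙ B t , ⊙-inKernel (- sgn r) {B t} (B-kernel t) ,
                 ⊙-normalise (sgn r) (B t) (R r) (sgn² r) (B-R-≺ t r R≺L) , support
      where
      open ExcludedRBeforeL r t e x∉
      support : ∀ k → ((- sgn r) ⊙ B t) k ≢ 0ℚ → k ≡ R r ⊎ k ≺c R r
      support k nz with endpointView k
      ... | left u refl with B-support-L t u (⊙-support (- sgn r) (B t) (L u) nz)
      ...   | refl = inj₂ (L-before t ℕP.≤-refl)
      support k nz | right k' refl with k' Fin.≟ r
      ... | yes refl = inj₁ refl
      ... | no k'≢r = inj₂ (R-before k' (B-support-R t k' (⊙-support (- sgn r) (B t) (R k') nz)) k'≢r)

    G-greedy : Greedy (G c)
    G-greedy x x∉ with endpointView x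
    ... | left Fin.zero refl = dependency-L0 x∉
    ... | left (Fin.suc t) refl = dependency-Lsuc t x∉
    ... | right r refl with endpointView (σ (R r))
    ...   | right t e = dependency-R-R r t e x∉
    ...   | left t e = dependency-R-L r t e x∉

-- G (R 0) is the set
-- of unit columns; passing from c to c+1 exchanges c for j = prev c, and
-- independence survives by `independent-exchange`, for a row functional
-- φ (a row of ψ(A) or the sum of two consecutive rows) that is ±1 at j and
-- vanishes on the rest of G (c+1).
module Independence (n' : ℕ) (q : Fin (suc n') → ℚ) (inc : StrictlyIncreasing q) where
  open import Defs using (StrictlyIncreasing; LinIndepCols; nextMod; sign)
  open CyclicOrder
  open FiniteSums
  open Columns
  open Succession using (module LeastIn)
  open import Data.Nat as ℕ using (ℕ; zero; suc)
  import Data.Nat.Properties as ℕP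
  open import Data.Fin as Fin using (Fin; toℕ)
  import Data.Fin.Properties as FinP
  open import Data.Fin.Subset using (Subset; _∈_; _∉_)
  open import Data.Rational using (ℚ; 0ℚ; 1ℚ; _+_; _*_; -_)
  import Data.Rational.Properties as ℚP
  open import Data.List using (allFin)
  open import Data.List.Membership.Propositional.Properties using (∈-allFin)
  open import Data.Product using (Σ; _×_; _,_; proj₁; proj₂)
  open import Data.Sum using (_⊎_; inj₁; inj₂)
  open import Relation.Binary.PropositionalEquality
  open import Relation.Nullary using (yes; no)
  open import Relation.Binary.Definitions using (tri<; tri≈; tri>)
  open import Data.Empty using (⊥-elim)

  open CandidateBasis n' q inc
  open Matrix n' q inc

  Independent : Subset (n ℕ.+ n) → Set
  Independent = LinIndepCols M

  G0-independent : Independent (G (R Fin.zero))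
  G0-independent w w-support w-ker x with endpointView x
  ... | left t refl = w-support (L t) (L∉G0 t)
  ... | right k refl = begin
    w (R k)                     ≡⟨ sym (ℚP.*-identityʳ (w (R k))) ⟩
    w (R k) * 1ℚ                ≡⟨ cong (w (R k) *_) (sym (trans (M-R k k) (δ-same k))) ⟩
    w (R k) * M k (R k)         ≡⟨ sym (sumF-single (λ y → w y * M k y) (R k) other-terms) ⟩
    comb w k                    ≡⟨ w-ker k ⟩
    0ℚ                          ∎
    where
    open ≡-Reasoning
    other-terms : ∀ y → y ≢ R k → w y * M k y ≡ 0ℚ
    other-terms y y≢ with endpointView y
    ... | left t refl = trans (cong (_* M k (L t)) (w-support (L t) (L∉G0 t))) (ℚP.*-zeroˡ (M k (L t)))
    ... | right k' refl = trans (cong (w (R k') *_) (trans (M-R k k') (δ-diff (λ e → y≢ (cong R (sym e))))))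
                                (ℚP.*-zeroʳ (w (R k')))

  unit² : ∀ {a s} → a ≡ s → s * s ≡ 1ℚ → a * a ≡ 1ℚ
  unit² refl s² = s²

  module Step (c : Lab) (φ : Lab → ℚ) (φ-ann : Annihilates φ)
    (vanish : ∀ k → k ≢ c → k ≢ prev c → φ k ≢ 0ℚ → k ∉ G c)
    (unit : φ (prev c) * φ (prev c) ≡ 1ℚ) where
    open Exchange c

    independent-next : Independent (G c) → Independent (G c')
    independent-next = independent-exchange j φ φ-ann φ-vanish unit G'-j⊆G
      where
      G'-j⊆G : ∀ k → k ∈ G c' → k ≢ j → k ∈ G c
      G'-j⊆G k k∈ k≢j = stable⁻ k≢j k∈
      φ-vanish : ∀ k → k ∈ G c' → k ≢ j → φ k ≡ 0ℚ
      φ-vanish k k∈ k≢j with φ k ℚP.≟ 0ℚ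
      ... | yes φk≡0 = φk≡0
      ... | no φk≢0 = ⊥-elim (vanish k (λ { refl → c∉G' k∈ }) k≢j φk≢0 (G'-j⊆G k k∈ k≢j))

  -- c = R 0: use row 0, which is supported on R 0 and L-columns
  step-R0 : Independent (G (R Fin.zero)) → Independent (G (nextMod (R Fin.zero)))
  step-R0 = Step.independent-next (R Fin.zero) (M Fin.zero) (row-annihilates Fin.zero) vanish unit
    where
    vanish : ∀ k → k ≢ R Fin.zero → k ≢ prev (R Fin.zero) → M Fin.zero k ≢ 0ℚ → k ∉ G (R Fin.zero)
    vanish k k≢c _ nz with endpointView k
    ... | left t refl = L∉G0 t
    ... | right k' refl with k' Fin.≟ Fin.zero
    ...   | yes refl = ⊥-elim (k≢c refl)
    ...   | no k'≢0 = ⊥-elim (nz (trans (M-R Fin.zero k') (δ-diff (λ e → k'≢0 (sym e)))))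
    unit : M Fin.zero (prev (R Fin.zero)) * M Fin.zero (prev (R Fin.zero)) ≡ 1ℚ
    unit rewrite prev-bot = unit² (M-L-≺ Fin.zero Fin.zero (R0-first (L Fin.zero) (λ e → R≢L (sym e))))
                                  (sgn² Fin.zero)

  -- c = R (u+1): use rows u and u+1, whose sum is supported on R u, R (u+1)
  -- and the L-columns read between them
  module StepRsuc (u : Fin n') where
    r r₁ : Fin n
    r = Fin.suc u
    r₁ = Fin.inject₁ u

    c : Lab
    c = R r

    φ : Lab → ℚ
    φ k = M r₁ k + M r k

    r₁≡u : toℕ r₁ ≡ toℕ u
    r₁≡u = FinP.toℕ-inject₁ u

    r₁<r : toℕ r₁ ℕ.< toℕ r
    r₁<r = subst (ℕ._< suc (toℕ u)) (sym r₁≡u) (ℕP.n<1+n _)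

    r₁≺r : R r₁ ≺ R r
    r₁≺r = R≺R r₁<r

    sgn-r₁ : sgn r₁ ≡ - sgn r
    sgn-r₁ = cong sign (trans (cong (λ z → n ℕ.∸ suc z) r₁≡u) (ℕP.+-∸-assoc 1 (FinP.toℕ<n u)))

    φ-R : ∀ k → φ (R k) ≢ 0ℚ → k ≡ r₁ ⊎ k ≡ r
    φ-R k nz with k Fin.≟ r₁ | k Fin.≟ r
    ... | yes k≡r₁ | _ = inj₁ k≡r₁
    ... | no _ | yes k≡r = inj₂ k≡r
    ... | no k≢r₁ | no k≢r = ⊥-elim (nz (cong₂ _+_ (trans (M-R r₁ k) (δ-diff (λ e → k≢r₁ (sym e))))
                                                   (trans (M-R r k) (δ-diff (λ e → k≢r (sym e))))))

    φ-L : ∀ t → φ (L t) ≢ 0ℚ → R r₁ ≺ L t × L t ≺ R r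
    φ-L t nz with R r₁ ≺? L t | R r ≺? L t
    ... | no r₁⊀t | no r⊀t = ⊥-elim (nz (cong₂ _+_ (M-L-⊀ r₁ t r₁⊀t) (M-L-⊀ r t r⊀t)))
    ... | no r₁⊀t | yes r≺t = ⊥-elim (r₁⊀t (≺-trans r₁≺r r≺t))
    ... | yes r₁≺t | yes r≺t = ⊥-elim (nz (trans (cong₂ _+_ (trans (M-L-≺ r₁ t r₁≺t) sgn-r₁) (M-L-≺ r t r≺t))
                                                 (ℚP.+-inverseˡ (sgn r))))
    ... | yes r₁≺t | no r⊀t with ≺-trichotomy (L t) (R r)
    ...   | inj₁ e = ⊥-elim (R≢L (sym e))
    ...   | inj₂ (inj₁ t≺r) = r₁≺t , t≺r
    ...   | inj₂ (inj₂ r≺t) = ⊥-elim (r⊀t r≺t)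

    vanish-R : R r₁ ≢ prev c → R r₁ ∉ G c
    vanish-R r₁≢j with endpointView (σ (R r₁))
    ... | right t e = ⊥-elim (r₁≢j (σ≡⇒prev (trans e (cong R t≡r))))
      where
      t≡r : t ≡ r
      t≡r = FinP.toℕ-injective (trans (σ-R-R r₁ t e) (cong suc r₁≡u))
    ... | left t e = ∉G-ascent (σ-R-label r₁) (subst₂ ℕ._<_ (sym (toℕ-R r₁)) (sym (toℕ-R r)) r₁<r)
                              (subst (λ z → toℕ c ℕ.≤ toℕ z) (sym e) (ℕP.<⇒≤ (R<L-label r t)))

    vanish-L : ∀ t → R r₁ ≺ L t → L t ≺ R r → L t ≢ prev c → L t ∉ G c
    vanish-L t r₁≺t t≺r t≢j with covers-above (σ-covers (L t) (λ e → top-maximal (subst (_≺ R r) e t≺r))) t≺r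
    ... | inj₁ c≡σt = ⊥-elim (t≢j (σ≡⇒prev (sym c≡σt)))
    ... | inj₂ σt≺c with endpointView (σ (L t))
    ...   | right u' e = ⊥-elim (ℕP.<-irrefl refl (ℕP.<-≤-trans
              (subst (ℕ._< toℕ u') r₁≡u (R≺R⁻ (≺-trans r₁≺t (subst (L t ≺_) e t≺σt))))
              (ℕP.≤-pred (R≺R⁻ (subst (_≺ R r) e σt≺c)))))
      where
      t≺σt : L t ≺ σ (L t)
      t≺σt = proj₁ (σ-covers (L t) (λ e' → top-maximal (subst (_≺ R r) e' t≺r)))
    ...   | left u' e = ∉G-descent (σ-L-label t)
                          (inj₁ (subst (λ z → toℕ c ℕ.≤ toℕ z) (sym e) (ℕP.<⇒≤ (R<L-label r u'))))

    vanish : ∀ k → k ≢ c → k ≢ prev c → φ k ≢ 0ℚ → k ∉ G c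
    vanish k k≢c k≢j nz with endpointView k
    ... | right k' refl with φ-R k' nz
    ...   | inj₁ refl = vanish-R k≢j
    ...   | inj₂ refl = ⊥-elim (k≢c refl)
    vanish k k≢c k≢j nz | left t refl with φ-L t nz
    ...   | r₁≺t , t≺r = vanish-L t r₁≺t t≺r k≢j

    unit : φ (prev c) * φ (prev c) ≡ 1ℚ
    unit with endpointView (prev c)
    ... | right u' e = unit² value refl
      where
      u'≡r₁ : u' ≡ r₁
      u'≡r₁ = FinP.toℕ-injective (trans (ℕP.suc-injective (sym (σ-R-R u' r (trans (cong σ (sym e)) (σ-prev c)))))
                                        (sym r₁≡u))
      value : φ (prev c) ≡ 1ℚ
      value rewrite e | u'≡r₁ | M-R r₁ r₁ | M-R r r₁ | δ-same {n} r₁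
                  | δ-diff {n} {r₁} {r} (λ e' → ℕP.<-irrefl (cong toℕ (sym e')) r₁<r) = refl
    ... | left t e = unit² value (sgn² r₁)
      where
      covered : Covers (L t) c
      covered = subst (λ z → Covers z c) e (prev-covered c c≢R0)
        where
        c≢R0 : c ≢ R Fin.zero
        c≢R0 e' with R-injective e'
        ... | ()
      r₁≺t : R r₁ ≺ L t
      r₁≺t with ≺-trichotomy (R r₁) (L t)
      ... | inj₁ e' = ⊥-elim (R≢L e')
      ... | inj₂ (inj₁ r₁≺t) = r₁≺t
      ... | inj₂ (inj₂ t≺r₁) = ⊥-elim (proj₂ covered (R r₁) (t≺r₁ , r₁≺r))
      value : φ (prev c) ≡ sgn r₁
      value rewrite e = trans (cong₂ _+_ (M-L-≺ r₁ t r₁≺t) (M-L-⊀ r t (λ r≺t → ≺-asym r≺t (proj₁ covered))))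
                              (ℚP.+-identityʳ (sgn r₁))

    independent-next : Independent (G c) → Independent (G (nextMod c))
    independent-next = Step.independent-next c φ (rows-annihilate r₁ r) vanish unit

  -- c = L i: use the row ρ of the last right endpoint R ρ read before L i;
  -- row ρ is supported on R ρ and the L-columns read after R ρ
  module StepL (i : Fin n) where
    c : Lab
    c = L i

    >-trichotomy : ∀ (a b : Fin n) → a ≡ b ⊎ toℕ b ℕ.< toℕ a ⊎ toℕ a ℕ.< toℕ b
    >-trichotomy a b with ℕP.<-cmp (toℕ a) (toℕ b)
    ... | tri< a<b _ _ = inj₂ (inj₂ a<b)
    ... | tri≈ _ a≡b _ = inj₁ (FinP.toℕ-injective a≡b)
    ... | tri> _ _ b<a = inj₂ (inj₁ b<a)

    open LeastIn (λ a b → toℕ b ℕ.< toℕ a) >-trichotomy (λ ab bc → ℕP.<-trans bc ab)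
      renaming (leastIn to greatestIn)

    lastRBefore : Σ (Fin n) λ ρ → R ρ ≺ c × (∀ k → R k ≺ c → toℕ k ℕ.≤ toℕ ρ)
    lastRBefore with greatestIn (λ k → R k ≺ c) (λ k → R k ≺? c) (allFin n)
    ... | inj₂ none = ⊥-elim (none Fin.zero (∈-allFin Fin.zero) (R0-first c (λ e → R≢L (sym e))))
    ... | inj₁ (ρ , ρ≺c , greatest) = ρ , ρ≺c , λ k k≺c → atMost (greatest k (∈-allFin k) k≺c)
      where
      atMost : ∀ {k} → k ≡ ρ ⊎ toℕ k ℕ.< toℕ ρ → toℕ k ℕ.≤ toℕ ρ
      atMost (inj₁ refl) = ℕP.≤-refl
      atMost (inj₂ k<ρ) = ℕP.<⇒≤ k<ρ

    ρ : Fin n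
    ρ = proj₁ lastRBefore

    ρ≺c : R ρ ≺ c
    ρ≺c = proj₁ (proj₂ lastRBefore)

    ρ-last : ∀ k → R k ≺ c → toℕ k ℕ.≤ toℕ ρ
    ρ-last = proj₂ (proj₂ lastRBefore)

    φ-R : ∀ k → M ρ (R k) ≢ 0ℚ → k ≡ ρ
    φ-R k nz with k Fin.≟ ρ
    ... | yes k≡ρ = k≡ρ
    ... | no k≢ρ = ⊥-elim (nz (trans (M-R ρ k) (δ-diff (λ e → k≢ρ (sym e)))))

    φ-L : ∀ t → M ρ (L t) ≢ 0ℚ → R ρ ≺ L t
    φ-L t nz with R ρ ≺? L t
    ... | yes ρ≺t = ρ≺t
    ... | no ρ⊀t = ⊥-elim (nz (M-L-⊀ ρ t ρ⊀t))

    vanish-R : R ρ ≢ prev c → R ρ ∉ G c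
    vanish-R ρ≢j with covers-above (σ-covers (R ρ) R≢L) ρ≺c
    ... | inj₁ c≡σρ = ⊥-elim (ρ≢j (σ≡⇒prev (sym c≡σρ)))
    ... | inj₂ σρ≺c with endpointView (σ (R ρ))
    ...   | right t e = ⊥-elim (ℕP.<-irrefl refl
              (subst (ℕ._≤ toℕ ρ) (σ-R-R ρ t e) (ρ-last t (subst (_≺ c) e σρ≺c))))
    ...   | left t e = ∉G-ascent (σ-R-label ρ) (R<L-label ρ i)
              (subst (λ z → toℕ c ℕ.≤ toℕ z) (sym e) (ℕP.<⇒≤ (L-label< (L≺L⁻ (subst (_≺ c) e σρ≺c)))))

    vanish-L : ∀ t → R ρ ≺ L t → t ≢ i → L t ≢ prev c → L t ∉ G c
    vanish-L t ρ≺t t≢i t≢j with ℕP.<-cmp (toℕ t) (toℕ i)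
    ... | tri≈ _ t≡i _ = ⊥-elim (t≢i (FinP.toℕ-injective t≡i))
    ... | tri< t<i _ _ = ∉G-descent (σ-L-label t) (inj₂ (L-label< t<i))
    ... | tri> _ _ i<t with covers-above (σ-covers (L t) (λ e → top-maximal (subst (_≺ c) e t≺c))) t≺c
      where
      t≺c : L t ≺ c
      t≺c = L≺L i<t
    ...   | inj₁ c≡σt = ⊥-elim (t≢j (σ≡⇒prev (sym c≡σt)))
    ...   | inj₂ σt≺c with endpointView (σ (L t))
    ...     | right u e = ⊥-elim (ℕP.<-irrefl refl (ℕP.<-≤-trans
                (R≺R⁻ (≺-trans ρ≺t (subst (L t ≺_) e t≺σt))) (ρ-last u (subst (_≺ c) e σt≺c))))
      where
      t≺σt : L t ≺ σ (L t)
      t≺σt = proj₁ (σ-covers (L t) (λ e' → top-maximal (subst (_≺ c) e' (L≺L i<t))))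
    ...     | left u e = ∉G-descent (σ-L-label t)
                (inj₁ (subst (λ z → toℕ c ℕ.≤ toℕ z) (sym e) (ℕP.<⇒≤ (L-label< (L≺L⁻ (subst (_≺ c) e σt≺c))))))

    vanish : ∀ k → k ≢ c → k ≢ prev c → M ρ k ≢ 0ℚ → k ∉ G c
    vanish k k≢c k≢j nz with endpointView k
    ... | right k' refl with φ-R k' nz
    ...   | refl = vanish-R k≢j
    vanish k k≢c k≢j nz | left t refl =
      vanish-L t (φ-L t nz) (λ { refl → k≢c refl }) k≢j

    unit : M ρ (prev c) * M ρ (prev c) ≡ 1ℚ
    unit with endpointView (prev c)
    ... | right u e = unit² value refl
      where
      covered : Covers (R u) c
      covered = subst (λ z → Covers z c) e (prev-covered c (λ e' → R≢L (sym e')))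
      u≡ρ : u ≡ ρ
      u≡ρ with ℕP.m≤n⇒m<n∨m≡n (ρ-last u (proj₁ covered))
      ... | inj₂ u≡ρ = FinP.toℕ-injective u≡ρ
      ... | inj₁ u<ρ = ⊥-elim (proj₂ covered (R ρ) (R≺R u<ρ , ρ≺c))
      value : M ρ (prev c) ≡ 1ℚ
      value rewrite e | u≡ρ = trans (M-R ρ ρ) (δ-same ρ)
    ... | left t e = unit² value (sgn² ρ)
      where
      covered : Covers (L t) c
      covered = subst (λ z → Covers z c) e (prev-covered c (λ e' → R≢L (sym e')))
      ρ≺t : R ρ ≺ L t
      ρ≺t with ≺-trichotomy (R ρ) (L t)
      ... | inj₁ e' = ⊥-elim (R≢L e')
      ... | inj₂ (inj₁ ρ≺t) = ρ≺t
      ... | inj₂ (inj₂ t≺ρ) = ⊥-elim (proj₂ covered (R ρ) (t≺ρ , ρ≺c))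
      value : M ρ (prev c) ≡ sgn ρ
      value rewrite e = M-L-≺ ρ t ρ≺t

    independent-next : Independent (G c) → Independent (G (nextMod c))
    independent-next = Step.independent-next c (M ρ) (row-annihilates ρ) vanish unit

  G-step : ∀ c → Independent (G c) → Independent (G (nextMod c))
  G-step c with endpointView c
  ... | right Fin.zero refl = step-R0
  ... | right (Fin.suc u) refl = StepRsuc.independent-next u
  ... | left i refl = StepL.independent-next i

  G-independent : ∀ c → Independent (G c)
  G-independent = nextMod-induction (λ c → Independent (G c)) G0-independent G-step

corollary5p8 : (n : ℕ) (q : Fin n → ℚ) →
    StrictlyIncreasing q → Canonical q →
    ((i : Fin (n Data.Nat.+ n)) → ∃ λ I → LexMinBasis q i I)
    × ((i : Fin (n Data.Nat.+ n)) (I J : Subset (n Data.Nat.+ n)) →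
         LexMinBasis q i I → LexMinBasis q (nextMod i) J →
         ∃ λ j → CycleStep q j i × j ≢ i × J ≡ (I - i) ∪ ⁅ j ⁆)
corollary5p8 Data.Nat.zero q _ _ = (λ ()) , (λ ())
corollary5p8 (Data.Nat.suc n') q inc _ = (λ c → G c , G-lexMin c) , cycleStep
  where
  open LexMin using (module GreedyBasis)
  open Witnesses n' q inc
  open Independence n' q inc using (G-independent)

  G-basis : ∀ c → IsBasis M (G c)
  G-basis c = ∣G∣ c , G-independent c

  G-lexMin : ∀ c → LexMinBasis q c (G c)
  G-lexMin c = G-basis c , GreedyBasis.greedy⇒lexMin M c (G c) (DependenciesFrom.G-greedy c)

  G-unique : ∀ c I → LexMinBasis q c I → I ≡ G c
  G-unique c I (I-basis , I-min) =
    GreedyBasis.greedy⇒lexMin-unique M c (G c) (DependenciesFrom.G-greedy c) (G-basis c) I I-basis I-min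

  cycleStep : ∀ c I J → LexMinBasis q c I → LexMinBasis q (nextMod c) J →
              ∃ λ j → CycleStep q j c × j ≢ c × J ≡ (I - c) ∪ ⁅ j ⁆
  cycleStep c I J I-min J-min =
    prev c , next⇒cycleStep (prev-spec c) , prev≢ c ,
    trans (G-unique (nextMod c) J J-min)
          (trans (Exchange.G-exchange c) (cong (λ S → (S - c) ∪ ⁅ prev c ⁆) (sym (G-unique c I I-min))))
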